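{- Let $G$ be a connected, nonhamiltonian, locally linear graph with $n \ge 3$ vertices. Then the maximum degree satisfies $\Delta(G) \le n-5$. Moreover, for every $n \ge 12$ there exists a connected, nonhamiltonian, locally linear graph of order $n$ with maximum degree exactly $n-5$.
   Context: All graphs are finite, simple and connected. For a vertex $v$ of a graph $G$, $N(v)$ is the set of neighbours of $v$ and $G[S]$ is the subgraph induced by a vertex set $S$. A graph $G$ is locally linear if for every vertex $v$ of $G$ the induced subgraph $G[N(v)]$ is a path. A graph is hamiltonian if it contains a cycle through all of its vertices. $\Delta(G)$ denotes the maximum degree of $G$. -}

module Defs where

open import Data.Nat using (ℕ; zero; suc; _+_; _≤_; _⊔_)
open import Data.Nat.Properties using ()
open import Data.Fin using (Fin; toℕ)
open import Data.Bool using (Bool; true; false; if_then_else_)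
open import Data.List using (List; map; foldr; allFin)
open import Data.Nat.ListAction using (sum)
open import Data.Empty using (⊥)
open import Data.Product using (Σ; _×_; _,_)
open import Relation.Binary.PropositionalEquality using (_≡_)
open import Function.Definitions using (Injective)
open import Relation.Nullary using (¬_)
open import Data.Sum using (_⊎_)

record Graph (n : ℕ) : Set where
  field
    adj   : Fin n → Fin n → Bool
    sym   : ∀ u v → adj u v ≡ adj v u
    irrfl : ∀ v → adj v v ≡ false
open Graph public

Adj : ∀ {n} → Graph n → Fin n → Fin n → Set
Adj G u v = adj G u v ≡ true

data Reachable {n : ℕ} (G : Graph n) : Fin n → Fin n → Set where
  here : ∀ {v} → Reachable G v v
  step : ∀ {u w v} → Adj G u w → Reachable G w v → Reachable G u v

Connected : ∀ {n} → Graph n → Set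
Connected G = ∀ u v → Reachable G u v

degree : ∀ {n} → Graph n → Fin n → ℕ
degree {n} G v = sum (map (λ u → if adj G v u then 1 else 0) (allFin n))

maxDegree : ∀ {n} → Graph n → ℕ
maxDegree {n} G = foldr _⊔_ 0 (map (degree G) (allFin n))

sucMod : ∀ {m} → Fin (suc m) → Fin (suc m)
sucMod {zero}  _ = Fin.zero
sucMod {suc m} Fin.zero = Fin.suc Fin.zero
sucMod {suc m} (Fin.suc i) with sucMod {m} i
... | Fin.zero  = Fin.zero
... | Fin.suc j = Fin.suc (Fin.suc j)

-- Hamiltonian: a cycle (at least 3 vertices) through all vertices,
-- given as a cyclic ordering σ of all the vertices with consecutive
-- vertices (cyclically) adjacent.
Hamiltonian : ∀ {n} → Graph n → Set
Hamiltonian {zero}  G = ⊥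
Hamiltonian {suc m} G =
  (3 ≤ suc m) ×
  Σ (Fin (suc m) → Fin (suc m)) λ σ →
    Injective _≡_ _≡_ σ × (∀ i → Adj G (σ i) (σ (sucMod i)))

Consecutive : ∀ {k} → Fin k → Fin k → Set
Consecutive i j = (suc (toℕ i) ≡ toℕ j) ⊎ (suc (toℕ j) ≡ toℕ i)

-- G[N(v)] is a path: N(v) can be enumerated without repetition as
-- w 0, ..., w k (k+1 ≥ 1 vertices) such that w i and w j are adjacent
-- exactly when |i - j| = 1 (i.e. G[N(v)] is isomorphic to P_{k+1}).
NeighbourhoodIsPath : ∀ {n} → Graph n → Fin n → Set
NeighbourhoodIsPath {n} G v =
  Σ ℕ λ k → Σ (Fin (suc k) → Fin n) λ w →
    Injective _≡_ _≡_ w ×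
    (∀ i → Adj G v (w i)) ×
    (∀ u → Adj G v u → Σ (Fin (suc k)) λ i → w i ≡ u) ×
    (∀ i j → (Adj G (w i) (w j) → Consecutive i j) × (Consecutive i j → Adj G (w i) (w j)))

LocallyLinear : ∀ {n} → Graph n → Set
LocallyLinear G = ∀ v → NeighbourhoodIsPath G v

{-# OPTIONS --safe #-}
-- Let v have maximum degree and let R be the set of vertices other than v that are not adjacent to v;
-- if Δ ≥ n − 4 then |R| ≤ 3.  Since N(v) is a path w₀ ⋯ w_k, the walk v w₀ ⋯ w_k v is a cycle, and every
-- component of G[R] (a vertex, an edge, a path with three vertices or a triangle) can be threaded into it
-- between two consecutive vertices w_j, w_{j+1}: connectivity gives an edge from the component to the path,
-- and the path structure of the neighbourhoods involved produces such a pair adjacent to the two ends of a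
-- Hamiltonian path of the component.  Two components never claim the same pair, since w_{j+1} would then
-- have three neighbours on the path N(w_j).  So G would be Hamiltonian.
--
-- For sharpness, join a vertex 0 to a path 5 ⋯ n−1 and attach a gadget on 1, …, 4 whose vertices of degree
-- two force every Hamiltonian cycle to close up early on 1 3 7 8 9 4.
module Submission where

open import Defs hiding (sym)
open import Data.Bool using (Bool; true; false; if_then_else_; _∨_; T) renaming (_≟_ to _≟ᵇ_)
open import Data.Bool.Properties using (T-≡; T-∨; ∨-comm)
open import Data.Empty using (⊥; ⊥-elim)
open import Data.Fin using (Fin; toℕ; zero; suc; punchOut; fromℕ<) renaming (_≟_ to _≟ᶠ_)
open import Data.Fin.Patterns using (0F; 1F; 2F; 3F; 4F; 5F; 6F; 7F; 8F; 9F)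
open import Data.Fin.Properties using (toℕ-injective; toℕ<n; toℕ-fromℕ<; any?; punchOut-injective; injective⇒≤)
open import Data.List using (List; []; _∷_; _++_; _ʳ++_; reverse; length; map; foldr; allFin; filter; applyUpTo)
open import Data.List.Properties using (length-++; length-map; length-tabulate; length-applyUpTo; ++-assoc; ++-identityʳ; ++-ʳ++; ʳ++-defn)
open import Data.List.Membership.Propositional using (_∈_; _∉_)
import Data.List.Membership.DecPropositional as DecMembership
open import Data.List.Relation.Binary.Subset.Propositional using (_⊆_)
open import Data.List.Membership.Propositional.Properties
  using (∈-allFin; ∈-++⁺ˡ; ∈-++⁺ʳ; ∈-++⁻; ∈-map⁺; ∈-map⁻; ∈-filter⁺; ∈-filter⁻; ∈-applyUpTo⁺; ∈-applyUpTo⁻)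
open import Data.List.Membership.Propositional.Properties.WithK using (unique∧set⇒bag)
open import Data.List.Relation.Binary.BagAndSetEquality using (∼bag⇒↭)
open import Data.List.Relation.Binary.Permutation.Propositional.Properties using (↭-length)
open import Data.List.Relation.Unary.Any using (here; there)
import Data.List.Relation.Unary.Any.Properties as Any
open import Data.List.Relation.Unary.All as All using (All; []; _∷_)
open import Data.List.Relation.Unary.AllPairs using ([]; _∷_)
open import Data.List.Relation.Unary.Linked using (Linked; []; [-]; _∷_)
open import Data.List.Relation.Unary.Unique.Propositional using (Unique)
import Data.List.Relation.Unary.Unique.DecPropositional as DecUnique
open import Data.List.Relation.Unary.Unique.Propositional.Properties using (allFin⁺; filter⁺; ++⁺; map⁺; applyUpTo⁺₁)
open import Data.Nat using (ℕ; zero; suc; _+_; _∸_; _≤_; _<_; _⊔_; z≤n; s≤s; s≤s⁻¹; _<?_; _≤?_; _≡ᵇ_; _≤ᵇ_)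
open import Data.Nat.ListAction using (sum)
open import Data.Nat.Properties
open import Data.Product using (Σ; _×_; _,_; proj₁; proj₂)
open import Data.Sum using (_⊎_; inj₁; inj₂; [_,_]′)
import Data.Sum as Sum
open import Function.Base using (_∘_; case_of_)
open import Function.Bundles using (_⇔_; mk⇔; Equivalence)
open import Function.Definitions using (Injective)
open import Relation.Binary.PropositionalEquality
  using (_≡_; _≢_; refl; sym; trans; cong; cong₂; subst; subst₂; module ≡-Reasoning)
open import Relation.Nullary using (¬_; Dec; yes; no; ¬?; _×-dec_; _→-dec_)
open import Relation.Nullary.Decidable using (decidable-stable; True; toWitness)
open import Relation.Unary using (Decidable)
open import Relation.Binary.Definitions using (tri<; tri≈; tri>)

private
  variable
    A : Set
    n : ℕ

pattern ∈₀ = here refl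
pattern ∈₁ = there ∈₀
pattern ∈₂ = there ∈₁

All∈⇒⊆ : ∀ {A : Set} {xs ys : List A} → All (_∈ ys) xs → xs ⊆ ys
All∈⇒⊆ = All.lookup

unique₃ : ∀ {A : Set} {x y z : A} → x ≢ y → x ≢ z → y ≢ z → Unique (x ∷ y ∷ z ∷ [])
unique₃ x≢y x≢z y≢z = (x≢y ∷ x≢z ∷ []) ∷ (y≢z ∷ []) ∷ [] ∷ []

length-≡-by-members : {xs ys : List A} → Unique xs → Unique ys →
                      (∀ {x} → x ∈ xs ⇔ x ∈ ys) → length xs ≡ length ys
length-≡-by-members uxs uys same = ↭-length (∼bag⇒↭ (unique∧set⇒bag uxs uys same))

length-of-enumeration : (xs : List (Fin n)) → Unique xs → (∀ u → u ∈ xs) → length xs ≡ n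
length-of-enumeration {n} xs uxs cover =
  trans (length-≡-by-members uxs (allFin⁺ n) (mk⇔ (λ _ → ∈-allFin _) (λ _ → cover _)))
        (length-tabulate (λ i → i))

nth : A → List A → ℕ → A
nth d []       _       = d
nth d (x ∷ xs) zero    = x
nth d (x ∷ xs) (suc j) = nth d xs j

module _ (d : A) where

  nth-∈ : ∀ xs {j} → j < length xs → nth d xs j ∈ xs
  nth-∈ (x ∷ xs) {zero}  _       = here refl
  nth-∈ (x ∷ xs) {suc j} (s≤s p) = there (nth-∈ xs p)

  nth-injective : ∀ {xs a b} → Unique xs → a < length xs → b < length xs →
                  nth d xs a ≡ nth d xs b → a ≡ b
  nth-injective {_ ∷ _}  {zero}  {zero}  _          _       _       _ = refl
  nth-injective {_ ∷ xs} {zero}  {suc b} (x∉ ∷ _)   _       (s≤s q) e = ⊥-elim (All.lookup x∉ (nth-∈ xs q) e)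
  nth-injective {_ ∷ xs} {suc a} {zero}  (x∉ ∷ _)   (s≤s p) _       e = ⊥-elim (All.lookup x∉ (nth-∈ xs p) (sym e))
  nth-injective {_ ∷ _}  {suc a} {suc b} (_ ∷ uxs)  (s≤s p) (s≤s q) e = cong suc (nth-injective uxs p q e)

  nth-linked : ∀ {R : A → A → Set} {xs} → Linked R xs → ∀ {j} → suc j < length xs →
               R (nth d xs j) (nth d xs (suc j))
  nth-linked (r ∷ _)  {zero}  _       = r
  nth-linked (_ ∷ rs) {suc j} (s≤s p) = nth-linked rs p
  nth-linked [-]      {_}     (s≤s ())

  nth-++ˡ : ∀ xs {ys j} → j < length xs → nth d (xs ++ ys) j ≡ nth d xs j
  nth-++ˡ (x ∷ xs) {j = zero}  _       = refl
  nth-++ˡ (x ∷ xs) {j = suc j} (s≤s p) = nth-++ˡ xs p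

  nth-applyUpTo : ∀ f {n a} → a < n → nth d (applyUpTo f n) a ≡ f a
  nth-applyUpTo f {suc n} {zero}  _       = refl
  nth-applyUpTo f {suc n} {suc a} (s≤s p) = nth-applyUpTo (f ∘ suc) p

  nth-index : ∀ {xs x} → x ∈ xs → Σ ℕ λ j → j < length xs × nth d xs j ≡ x
  nth-index (here refl) = 0 , s≤s z≤n , refl
  nth-index (there m)   = let (j , j< , e) = nth-index m in suc j , s≤s j< , e

  nth-++-length : ∀ xs {y ys} → nth d (xs ++ y ∷ ys) (length xs) ≡ y
  nth-++-length []       = refl
  nth-++-length (x ∷ xs) = nth-++-length xs

module _ {A : Set} where

  Linked-ʳ++ : ∀ {R : A → A → Set} → (∀ {x y} → R x y → R y x) →
               ∀ {x acc ys} → Linked R (x ∷ acc) → Linked R (x ∷ ys) → Linked R (ys ʳ++ x ∷ acc)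
  Linked-ʳ++ R-sym {ys = []}     l  _        = l
  Linked-ʳ++ R-sym {ys = y ∷ ys} l (r ∷ l′) = Linked-ʳ++ R-sym (R-sym r ∷ l) l′

  Linked-reverse-chain : ∀ {R : A → A → Set} → (∀ {x y} → R x y → R y x) →
                         ∀ {x y} ch → Linked R (x ∷ ch ++ y ∷ []) → Linked R (y ∷ reverse ch ++ x ∷ [])
  Linked-reverse-chain R-sym {x} {y} ch l =
    subst (Linked _) (trans (++-ʳ++ ch) (cong (y ∷_) (ʳ++-defn ch))) (Linked-ʳ++ R-sym [-] l)

  Unique-ʳ++ : ∀ {ys acc : List A} → Unique ys → Unique acc → (∀ {x} → x ∈ ys → x ∉ acc) → Unique (ys ʳ++ acc)
  Unique-ʳ++ {[]}     _              u-acc _    = u-acc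
  Unique-ʳ++ {y ∷ ys} (y∉ys ∷ u-ys) u-acc disj =
    Unique-ʳ++ u-ys (All.tabulate (λ m e → disj (here (sym e)) m) ∷ u-acc) λ where
      m (here refl) → All.lookup y∉ys m refl
      m (there m′)  → disj (there m) m′

  Unique-reverse : ∀ {xs : List A} → Unique xs → Unique (reverse xs)
  Unique-reverse u = Unique-ʳ++ u [] λ _ ()

  spliceTail : (ℕ → A) → (ℕ → List A) → ℕ → List A
  spliceTail f ins zero    = []
  spliceTail f ins (suc c) = ins 0 ++ f 1 ∷ spliceTail (f ∘ suc) (ins ∘ suc) c

  -- splice f ins c = f 0 ∷ ins 0 ++ f 1 ∷ ins 1 ++ ⋯ ++ ins (c ∸ 1) ++ f c ∷ []
  splice : (ℕ → A) → (ℕ → List A) → ℕ → List A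
  splice f ins c = f 0 ∷ spliceTail f ins c

  private
    Linked-join : ∀ {R : A → A → Set} xs {y ys} → Linked R (xs ++ y ∷ []) → Linked R (y ∷ ys) → Linked R (xs ++ y ∷ ys)
    Linked-join []            _        l = l
    Linked-join (x ∷ [])      (r ∷ _)  l = r ∷ l
    Linked-join (x ∷ x′ ∷ xs) (r ∷ l₁) l = r ∷ Linked-join (x′ ∷ xs) l₁ l

  splice-linked : ∀ {R : A → A → Set} f ins c {tl} →
                  (∀ {j} → j < c → Linked R (f j ∷ ins j ++ f (suc j) ∷ [])) →
                  Linked R (f c ∷ tl) → Linked R (splice f ins c ++ tl)
  splice-linked f ins zero    slots last = last
  splice-linked f ins (suc c) slots last =
    subst (λ xs → Linked _ (f 0 ∷ xs)) (sym (++-assoc (ins 0) (splice (f ∘ suc) (ins ∘ suc) c) _))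
      (Linked-join (f 0 ∷ ins 0) (slots (s≤s z≤n)) (splice-linked (f ∘ suc) (ins ∘ suc) c (slots ∘ s≤s) last))

  ∈-splice⁻ : ∀ f ins c {x} → x ∈ splice f ins c →
              (Σ ℕ λ j → j ≤ c × x ≡ f j) ⊎ (Σ ℕ λ j → j < c × x ∈ ins j)
  ∈-splice⁻ f ins c       (here e) = inj₁ (0 , z≤n , e)
  ∈-splice⁻ f ins (suc c) (there m) with ∈-++⁻ (ins 0) m
  ... | inj₁ m₀ = inj₂ (0 , s≤s z≤n , m₀)
  ... | inj₂ m₁ with ∈-splice⁻ (f ∘ suc) (ins ∘ suc) c m₁
  ...   | inj₁ (j , j≤c , e) = inj₁ (suc j , s≤s j≤c , e)
  ...   | inj₂ (j , j<c , m) = inj₂ (suc j , s≤s j<c , m)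

  f∈splice : ∀ f ins {c j} → j ≤ c → f j ∈ splice f ins c
  f∈splice f ins {c}     {zero}  _       = here refl
  f∈splice f ins {suc c} {suc j} (s≤s p) = there (∈-++⁺ʳ (ins 0) (f∈splice (f ∘ suc) (ins ∘ suc) p))

  ins⊆splice : ∀ f ins {c j x} → j < c → x ∈ ins j → x ∈ splice f ins c
  ins⊆splice f ins {suc c} {zero}  _       m = there (∈-++⁺ˡ m)
  ins⊆splice f ins {suc c} {suc j} (s≤s p) m = there (∈-++⁺ʳ (ins 0) (ins⊆splice (f ∘ suc) (ins ∘ suc) p m))

  splice-unique : ∀ f ins c →
                  (∀ {a b} → a ≤ c → b ≤ c → f a ≡ f b → a ≡ b) →
                  (∀ {j a x} → x ∈ ins j → x ≢ f a) →
                  (∀ j → Unique (ins j)) →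
                  (∀ {i j x} → x ∈ ins i → x ∈ ins j → i ≡ j) →
                  Unique (splice f ins c)
  splice-unique f ins zero    _     _       _      _        = [] ∷ []
  splice-unique f ins (suc c) f-inj ins≢f ins-uniq ins-disj =
    All.tabulate f0∉ ∷ ++⁺ (ins-uniq 0) rest-unique (λ (m₀ , m) → disjoint m₀ m)
    where
    rest-unique : Unique (splice (f ∘ suc) (ins ∘ suc) c)
    rest-unique = splice-unique (f ∘ suc) (ins ∘ suc) c (λ a≤ b≤ e → suc-injective (f-inj (s≤s a≤) (s≤s b≤) e))
                    ins≢f (ins-uniq ∘ suc) (λ m m′ → suc-injective (ins-disj m m′))
    f0∉ : ∀ {y} → y ∈ ins 0 ++ splice (f ∘ suc) (ins ∘ suc) c → f 0 ≢ y
    f0∉ m e with ∈-++⁻ (ins 0) m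
    ... | inj₁ m₀ = ins≢f m₀ (sym e)
    ... | inj₂ m₁ with ∈-splice⁻ (f ∘ suc) (ins ∘ suc) c m₁
    ...   | inj₁ (j , j≤c , e′) = 0≢1+n (f-inj z≤n (s≤s j≤c) (trans e e′))
    ...   | inj₂ (j , _ , m)    = ins≢f m (sym e)
    disjoint : ∀ {y} → y ∈ ins 0 → ¬ y ∈ splice (f ∘ suc) (ins ∘ suc) c
    disjoint m₀ m with ∈-splice⁻ (f ∘ suc) (ins ∘ suc) c m
    ... | inj₁ (j , _ , e) = ins≢f m₀ e
    ... | inj₂ (j , _ , m) = 0≢1+n (ins-disj m₀ m)

clamp : ∀ {m} → ℕ → Fin (suc m)
clamp {zero}  _       = zero
clamp {suc m} zero    = zero
clamp {suc m} (suc j) = suc (clamp j)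

toℕ-clamp : ∀ {m} j → j ≤ m → toℕ (clamp {m} j) ≡ j
toℕ-clamp {zero}  zero    _       = refl
toℕ-clamp {suc m} zero    _       = refl
toℕ-clamp {suc m} (suc j) (s≤s p) = cong suc (toℕ-clamp j p)

clamp-toℕ : ∀ {m} (i : Fin (suc m)) → clamp (toℕ i) ≡ i
clamp-toℕ i = toℕ-injective (toℕ-clamp (toℕ i) (s≤s⁻¹ (toℕ<n i)))

sucMod-last : ∀ {m} (i : Fin (suc m)) → toℕ i ≡ m → sucMod i ≡ zero
sucMod-last {zero}  zero    _ = refl
sucMod-last {suc m} (suc i) e with sucMod {m} i | sucMod-last i (suc-injective e)
... | zero | _ = refl

sucMod-< : ∀ {m} (i : Fin (suc m)) → toℕ i < m → toℕ (sucMod i) ≡ suc (toℕ i)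
sucMod-< {suc m} zero    _       = refl
sucMod-< {suc m} (suc i) (s≤s p) with sucMod {m} i | sucMod-< i p
... | suc j | e = cong suc e

sucMod-view : ∀ {m} (i : Fin (suc m)) → (toℕ i ≡ m × sucMod i ≡ zero) ⊎ (toℕ i < m × toℕ (sucMod i) ≡ suc (toℕ i))
sucMod-view {m} i with toℕ i <? m
... | yes i<m = inj₂ (i<m , sucMod-< i i<m)
... | no i≮m  = let i≡m = ≤-antisym (s≤s⁻¹ (toℕ<n i)) (≮⇒≥ i≮m) in inj₁ (i≡m , sucMod-last i i≡m)

sucMod-injective : ∀ {m} → Injective _≡_ _≡_ (sucMod {m})
sucMod-injective {m} {a} {b} e with sucMod-view a | sucMod-view b
... | inj₁ (a≡m , _)  | inj₁ (b≡m , _)  = toℕ-injective (trans a≡m (sym b≡m))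
... | inj₁ (_ , a↦0)  | inj₂ (_ , b↦)   = ⊥-elim (1+n≢0 (trans (sym b↦) (cong toℕ (trans (sym e) a↦0))))
... | inj₂ (_ , a↦)   | inj₁ (_ , b↦0)  = ⊥-elim (1+n≢0 (trans (sym a↦) (cong toℕ (trans e b↦0))))
... | inj₂ (_ , a↦)   | inj₂ (_ , b↦)   = toℕ-injective (suc-injective (trans (sym a↦) (trans (cong toℕ e) b↦)))

sucMod²≢id : ∀ {m} → 2 ≤ m → (i : Fin (suc m)) → sucMod (sucMod i) ≢ i
sucMod²≢id {suc zero} (s≤s ()) _
sucMod²≢id {suc (suc m)} _ i e with sucMod-view i | sucMod-view (sucMod i)
... | inj₁ (_ , i↦0)   | inj₁ (i′≡m , _)    = 0≢1+n (trans (cong toℕ (sym i↦0)) i′≡m)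
... | inj₁ (i≡m , i↦0) | inj₂ (_ , i′↦)     =
  1+n≢0 (suc-injective (trans (sym i≡m) (trans (cong toℕ (sym e)) (trans i′↦ (cong (suc ∘ toℕ) i↦0)))))
... | inj₂ (_ , i↦)    | inj₁ (i′≡m , i′↦0) =
  1+n≢0 (suc-injective (trans (sym i′≡m) (trans i↦ (cong suc (cong toℕ (trans (sym e) i′↦0))))))
... | inj₂ (_ , i↦)    | inj₂ (_ , i′↦)     =
  <-irrefl (trans (cong toℕ (sym e)) (trans i′↦ (cong suc i↦))) (m<n⇒m<1+n (n<1+n _))

sucMod-clamp : ∀ {m a} → a < m → sucMod (clamp {m} a) ≡ clamp (suc a)
sucMod-clamp {m} {a} a<m = toℕ-injective (begin
  toℕ (sucMod (clamp a)) ≡⟨ sucMod-< (clamp a) (subst (_< m) (sym (toℕ-clamp a (<⇒≤ a<m))) a<m) ⟩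
  suc (toℕ (clamp a))    ≡⟨ cong suc (toℕ-clamp a (<⇒≤ a<m)) ⟩
  suc a                  ≡⟨ toℕ-clamp (suc a) a<m ⟨
  toℕ (clamp (suc a))    ∎)
  where open ≡-Reasoning

sucMod-reaches : ∀ {m} {P : Fin (suc m) → Set} → (∀ i → P i → P (sucMod i)) → ∀ i j → P i → P j
sucMod-reaches {m} {P} closed i j pᵢ = subst P (clamp-toℕ j) (up z≤n (s≤s⁻¹ (toℕ<n j)) p₀)
  where
  up : ∀ {a b} → a ≤ b → b ≤ m → P (clamp a) → P (clamp b)
  up {b = zero}  z≤n   _     p = p
  up {b = suc b} a≤b+1 b+1≤m p with m≤n⇒m<n∨m≡n a≤b+1
  ... | inj₁ a<b+1 = subst P (sucMod-clamp b+1≤m) (closed _ (up (s≤s⁻¹ a<b+1) (<⇒≤ b+1≤m) p))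
  ... | inj₂ refl  = p
  p₀ : P (clamp 0)
  p₀ = subst P (trans (sucMod-last (clamp m) (toℕ-clamp m ≤-refl)) (sym (clamp-toℕ zero)))
         (closed _ (up (s≤s⁻¹ (toℕ<n i)) ≤-refl (subst P (sym (clamp-toℕ i)) pᵢ)))

injective⇒surjective : ∀ {m} (f : Fin m → Fin m) → Injective _≡_ _≡_ f → ∀ y → Σ (Fin m) λ i → f i ≡ y
injective⇒surjective {suc m} f f-inj y with any? (λ i → f i ≟ᶠ y)
... | yes (i , e) = i , e
... | no ∄i = ⊥-elim (<-irrefl refl (injective⇒≤ {f = f′} λ e → f-inj (punchOut-injective (y≢f _) (y≢f _) e)))
  where
  y≢f : ∀ i → y ≢ f i
  y≢f i y≡fi = ∄i (i , sym y≡fi)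
  f′ : Fin (suc m) → Fin m
  f′ i = punchOut (y≢f i)

module _ (G : Graph n) where

  Adj-sym : ∀ {x y} → Adj G x y → Adj G y x
  Adj-sym {x} {y} e = trans (Graph.sym G y x) e

  Adj-irrefl : ∀ {x} → ¬ Adj G x x
  Adj-irrefl {x} e with trans (sym (Graph.irrfl G x)) e
  ... | ()

  Adj⇒≢ : ∀ {x y} → Adj G x y → x ≢ y
  Adj⇒≢ h refl = Adj-irrefl h

  Adj? : ∀ x → Decidable (Adj G x)
  Adj? x y = adj G x y ≟ᵇ true

  Reachable-snoc : ∀ {x y z} → Reachable G x y → Adj G y z → Reachable G x z
  Reachable-snoc here       h′ = step h′ here
  Reachable-snoc (step h r) h′ = step h (Reachable-snoc r h′)

  Reachable-sym : ∀ {x y} → Reachable G x y → Reachable G y x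
  Reachable-sym here       = here
  Reachable-sym (step h r) = Reachable-snoc (Reachable-sym r) (Adj-sym h)

  Reachable-trans : ∀ {x y z} → Reachable G x y → Reachable G y z → Reachable G x z
  Reachable-trans here       r′ = r′
  Reachable-trans (step h r) r′ = step h (Reachable-trans r r′)

  connected-via-hub : (hub : Fin n) → (∀ u → Reachable G u hub) → Connected G
  connected-via-hub hub to-hub u w = Reachable-trans (to-hub u) (Reachable-sym (to-hub w))

  edge-leaving : {K : Fin n → Set} → Decidable K → ∀ {x y} → Reachable G x y → K x → ¬ K y →
                 Σ (Fin n) λ a → Σ (Fin n) λ b → K a × ¬ K b × Adj G a b
  edge-leaving K? here                   kx ¬ky = ⊥-elim (¬ky kx)
  edge-leaving K? (step {u} {w} h r) ku ¬ky with K? w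
  ... | yes kw = edge-leaving K? r kw ¬ky
  ... | no ¬kw = u , w , ku , ¬kw , h

hamiltonian-from-cycle : (G : Graph n) → 3 ≤ n → (v : Fin n) (L : List (Fin n)) → Unique (v ∷ L) →
                         (∀ u → u ∈ v ∷ L) → Linked (Adj G) (v ∷ L ++ v ∷ []) → Hamiltonian G
hamiltonian-from-cycle {suc m} G 3≤n v L uniq cover linked = 3≤n , σ , σ-injective , σ-adjacent
  where
  C C⁺ : List (Fin (suc m))
  C  = v ∷ L
  C⁺ = C ++ v ∷ []
  |C| : length C ≡ suc m
  |C| = length-of-enumeration C uniq cover
  |C⁺| : length C⁺ ≡ suc (suc m)
  |C⁺| = trans (length-++ C) (trans (+-comm (length C) 1) (cong suc |C|))
  σ : Fin (suc m) → Fin (suc m)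
  σ i = nth v C (toℕ i)
  i<|C| : ∀ (i : Fin (suc m)) → toℕ i < length C
  i<|C| i = subst (toℕ i <_) (sym |C|) (toℕ<n i)
  σ-injective : Injective _≡_ _≡_ σ
  σ-injective {i} {j} e = toℕ-injective (nth-injective v uniq (i<|C| i) (i<|C| j) e)
  σ⁺ : ∀ {j} → j < length C → nth v C⁺ j ≡ nth v C j
  σ⁺ = nth-++ˡ v C
  step⁺ : ∀ j → j ≤ m → Adj G (nth v C⁺ j) (nth v C⁺ (suc j))
  step⁺ j j≤m = nth-linked v linked (subst (suc (suc j) ≤_) (sym |C⁺|) (s≤s (s≤s j≤m)))
  σ-adjacent : ∀ i → Adj G (σ i) (σ (sucMod i))
  σ-adjacent i with toℕ i <? m
  ... | yes i<m =
    subst₂ (Adj G) (σ⁺ (i<|C| i))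
      (trans (σ⁺ (subst (suc (toℕ i) <_) (sym |C|) (s≤s i<m))) (cong (nth v C) (sym (sucMod-< i i<m))))
      (step⁺ (toℕ i) (<⇒≤ i<m))
  ... | no i≮m =
    subst₂ (Adj G) (σ⁺ (i<|C| i))
      (trans (cong (λ j → nth v C⁺ (suc j)) (trans i≡m (sym (suc-injective |C|))))
             (trans (nth-++-length v C) (cong σ (sym (sucMod-last i i≡m)))))
      (step⁺ (toℕ i) (≤-reflexive i≡m))
    where
    i≡m : toℕ i ≡ m
    i≡m = ≤-antisym (s≤s⁻¹ (toℕ<n i)) (≮⇒≥ i≮m)

module _ (G : Graph n) where

  Neighbours : Fin n → List (Fin n)
  Neighbours v = filter (Adj? G v) (allFin n)

  degree≡length-Neighbours : ∀ v → degree G v ≡ length (Neighbours v)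
  degree≡length-Neighbours v = count (allFin n)
    where
    count : ∀ xs → sum (map (λ u → if adj G v u then 1 else 0) xs) ≡ length (filter (Adj? G v) xs)
    count []       = refl
    count (x ∷ xs) with adj G v x
    ... | true  = cong suc (count xs)
    ... | false = count xs

  degree-by-enumeration : ∀ v {xs} → Unique xs → (∀ {u} → Adj G v u ⇔ u ∈ xs) → degree G v ≡ length xs
  degree-by-enumeration v uxs nbrs =
    trans (degree≡length-Neighbours v)
          (length-≡-by-members (filter⁺ (Adj? G v) (allFin⁺ n)) uxs
            (mk⇔ (λ m → Equivalence.to nbrs (proj₂ (∈-filter⁻ (Adj? G v) {xs = allFin n} m)))
                 (λ m → ∈-filter⁺ (Adj? G v) (∈-allFin _) (Equivalence.from nbrs m))))

  degree-path-neighbourhood : ∀ v → (P : NeighbourhoodIsPath G v) → degree G v ≡ suc (proj₁ P)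
  degree-path-neighbourhood v (k , w , w-injective , w-adjacent , w-onto , _) =
    trans (degree-by-enumeration v (map⁺ w-injective (allFin⁺ (suc k))) (mk⇔ listed adjacent))
          (trans (length-map w (allFin (suc k))) (length-tabulate (λ i → i)))
    where
    listed : ∀ {u} → Adj G v u → u ∈ map w (allFin (suc k))
    listed {u} h = let (i , e) = w-onto u h in subst (_∈ _) e (∈-map⁺ w (∈-allFin i))
    adjacent : ∀ {u} → u ∈ map w (allFin (suc k)) → Adj G v u
    adjacent m = let (i , _ , e) = ∈-map⁻ w m in subst (Adj G v) (sym e) (w-adjacent i)

  degree≤maxDegree : ∀ v → degree G v ≤ maxDegree G
  degree≤maxDegree v = ≤-max (∈-map⁺ (degree G) (∈-allFin v))
    where
    ≤-max : ∀ {xs x} → x ∈ xs → x ≤ foldr _⊔_ 0 xs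
    ≤-max {y ∷ _} (here refl) = m≤m⊔n y _
    ≤-max {y ∷ _} (there m)   = ≤-trans (≤-max m) (m≤n⊔m y _)

  maxDegree-lub : ∀ {b} → (∀ v → degree G v ≤ b) → maxDegree G ≤ b
  maxDegree-lub {b} bound = max-≤ (map (degree G) (allFin n)) λ m →
    let (v , _ , e) = ∈-map⁻ (degree G) m in subst (_≤ b) (sym e) (bound v)
    where
    max-≤ : ∀ xs → (∀ {x} → x ∈ xs → x ≤ b) → foldr _⊔_ 0 xs ≤ b
    max-≤ []       _ = z≤n
    max-≤ (x ∷ xs) h = ⊔-lub (h (here refl)) (max-≤ xs (h ∘ there))

-- Paths in neighbourhoods

-- Consecutive i j from Defs unfolds to Consecutiveℕ (toℕ i) (toℕ j).
Consecutiveℕ : ℕ → ℕ → Set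
Consecutiveℕ a b = (suc a ≡ b) ⊎ (suc b ≡ a)

consecutive-sym : ∀ {a b} → Consecutiveℕ a b → Consecutiveℕ b a
consecutive-sym (inj₁ e) = inj₂ e
consecutive-sym (inj₂ e) = inj₁ e

consecutive-at-most-two : ∀ {p a b c} → Consecutiveℕ p a → Consecutiveℕ p b → Consecutiveℕ p c →
                          a ≡ b ⊎ a ≡ c ⊎ b ≡ c
consecutive-at-most-two (inj₁ refl) (inj₁ refl) _           = inj₁ refl
consecutive-at-most-two (inj₂ refl) (inj₂ refl) _           = inj₁ refl
consecutive-at-most-two (inj₁ refl) (inj₂ refl) (inj₁ refl) = inj₂ (inj₁ refl)
consecutive-at-most-two (inj₁ refl) (inj₂ refl) (inj₂ refl) = inj₂ (inj₂ refl)
consecutive-at-most-two (inj₂ refl) (inj₁ refl) (inj₁ refl) = inj₂ (inj₂ refl)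
consecutive-at-most-two (inj₂ refl) (inj₁ refl) (inj₂ refl) = inj₂ (inj₁ refl)

consecutive-¬triangle : ∀ {a b c} → Consecutiveℕ a b → Consecutiveℕ b c → ¬ Consecutiveℕ a c
consecutive-¬triangle (inj₁ refl) (inj₁ refl) (inj₁ ())
consecutive-¬triangle (inj₁ refl) (inj₁ refl) (inj₂ ())
consecutive-¬triangle (inj₁ refl) (inj₂ refl) (inj₁ ())
consecutive-¬triangle (inj₁ refl) (inj₂ refl) (inj₂ ())
consecutive-¬triangle (inj₂ refl) (inj₁ refl) (inj₁ ())
consecutive-¬triangle (inj₂ refl) (inj₁ refl) (inj₂ ())
consecutive-¬triangle (inj₂ refl) (inj₂ refl) (inj₁ ())
consecutive-¬triangle (inj₂ refl) (inj₂ refl) (inj₂ ())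

consecutive-¬square : ∀ {a b c d} → Consecutiveℕ a b → Consecutiveℕ b c → Consecutiveℕ c d →
                      Consecutiveℕ d a → a ≢ c → b ≢ d → ⊥
consecutive-¬square (inj₁ refl) (inj₁ refl) (inj₁ refl) (inj₁ ()) _ _
consecutive-¬square (inj₁ refl) (inj₁ refl) (inj₁ refl) (inj₂ ()) _ _
consecutive-¬square (inj₁ refl) (inj₁ refl) (inj₂ refl) _ _ b≢d = b≢d refl
consecutive-¬square (inj₁ refl) (inj₂ refl) _ _ a≢c _ = a≢c refl
consecutive-¬square (inj₂ refl) (inj₁ refl) _ _ a≢c _ = a≢c refl
consecutive-¬square (inj₂ refl) (inj₂ refl) (inj₁ refl) _ _ b≢d = b≢d refl
consecutive-¬square (inj₂ refl) (inj₂ refl) (inj₂ refl) (inj₁ ()) _ _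
consecutive-¬square (inj₂ refl) (inj₂ refl) (inj₂ refl) (inj₂ ()) _ _

change-point : {P : ℕ → Set} → Decidable P → ∀ {a} b → a ≤ b → P a → ¬ P b →
               Σ ℕ λ j → suc j ≤ b × P j × ¬ P (suc j)
change-point P? zero    z≤n pa ¬pb = ⊥-elim (¬pb pa)
change-point P? (suc b) a≤b+1 pa ¬pb+1 with P? b
... | yes pb = b , ≤-refl , pb , ¬pb+1
... | no ¬pb with m≤n⇒m<n∨m≡n a≤b+1
...   | inj₁ a<b+1 = let (j , j<b , pj , ¬pj+1) = change-point P? b (s≤s⁻¹ a<b+1) pa ¬pb
                     in j , m≤n⇒m≤1+n j<b , pj , ¬pj+1
...   | inj₂ refl  = ⊥-elim (¬pb+1 pa)


module LocalPaths {n} (G : Graph n) (LL : LocallyLinear G) where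

  infix 4 _~_
  _~_ : Fin n → Fin n → Set
  _~_ = Adj G

  end : Fin n → ℕ
  end c = proj₁ (LL c)

  private
    path : ∀ c → Fin (suc (end c)) → Fin n
    path c = proj₁ (proj₂ (LL c))

    path-injective : ∀ c → Injective _≡_ _≡_ (path c)
    path-injective c = proj₁ (proj₂ (proj₂ (LL c)))

    path-surjective : ∀ c x → c ~ x → Σ (Fin (suc (end c))) λ i → path c i ≡ x
    path-surjective c = proj₁ (proj₂ (proj₂ (proj₂ (proj₂ (LL c)))))

    path-edges : ∀ c i j → (path c i ~ path c j → Consecutive i j) × (Consecutive i j → path c i ~ path c j)
    path-edges c = proj₂ (proj₂ (proj₂ (proj₂ (proj₂ (LL c)))))

  -- N(c) is the path nb c 0, nb c 1, …, nb c (end c); larger indices are clamped to end c.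
  nb : Fin n → ℕ → Fin n
  nb c j = path c (clamp j)

  nb-adj : ∀ c j → c ~ nb c j
  nb-adj c j = proj₁ (proj₂ (proj₂ (proj₂ (LL c)))) (clamp j)

  pos : ∀ c {x} → c ~ x → ℕ
  pos c {x} h = toℕ (proj₁ (path-surjective c x h))

  pos≤end : ∀ c {x} (h : c ~ x) → pos c h ≤ end c
  pos≤end c {x} h = s≤s⁻¹ (toℕ<n (proj₁ (path-surjective c x h)))

  nb-pos : ∀ c {x} (h : c ~ x) → nb c (pos c h) ≡ x
  nb-pos c {x} h = trans (cong (path c) (clamp-toℕ _)) (proj₂ (path-surjective c x h))

  nb-injective : ∀ c {i j} → i ≤ end c → j ≤ end c → nb c i ≡ nb c j → i ≡ j
  nb-injective c {i} {j} i≤ j≤ e =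
    trans (sym (toℕ-clamp i i≤)) (trans (cong toℕ (path-injective c e)) (toℕ-clamp j j≤))

  nb-≢ : ∀ c {i j} → i ≤ end c → j ≤ end c → i ≢ j → nb c i ≢ nb c j
  nb-≢ c i≤ j≤ i≢j = i≢j ∘ nb-injective c i≤ j≤

  consecutive⇒nb-adj : ∀ c {i j} → i ≤ end c → j ≤ end c → Consecutiveℕ i j → nb c i ~ nb c j
  consecutive⇒nb-adj c {i} {j} i≤ j≤ cij =
    proj₂ (path-edges c (clamp i) (clamp j)) (subst₂ Consecutiveℕ (sym (toℕ-clamp i i≤)) (sym (toℕ-clamp j j≤)) cij)

  nb-adj⇒consecutive : ∀ c {i j} → i ≤ end c → j ≤ end c → nb c i ~ nb c j → Consecutiveℕ i j
  nb-adj⇒consecutive c {i} {j} i≤ j≤ h =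
    subst₂ Consecutiveℕ (toℕ-clamp i i≤) (toℕ-clamp j j≤) (proj₁ (path-edges c (clamp i) (clamp j)) h)

  pos-consecutive : ∀ c {x y} (hx : c ~ x) (hy : c ~ y) → x ~ y → Consecutiveℕ (pos c hx) (pos c hy)
  pos-consecutive c hx hy h =
    nb-adj⇒consecutive c (pos≤end c hx) (pos≤end c hy) (subst₂ _~_ (sym (nb-pos c hx)) (sym (nb-pos c hy)) h)

  pos-≢ : ∀ c {x y} (hx : c ~ x) (hy : c ~ y) → x ≢ y → pos c hx ≢ pos c hy
  pos-≢ c hx hy x≢y e = x≢y (trans (sym (nb-pos c hx)) (trans (cong (nb c) e) (nb-pos c hy)))

  ¬three-local-neighbours : ∀ c {x a b d} → c ~ x → c ~ a → c ~ b → c ~ d → x ~ a → x ~ b → x ~ d →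
                            a ≢ b → a ≢ d → b ≢ d → ⊥
  ¬three-local-neighbours c hx ha hb hd xa xb xd a≢b a≢d b≢d
    with consecutive-at-most-two (pos-consecutive c hx ha xa) (pos-consecutive c hx hb xb) (pos-consecutive c hx hd xd)
  ... | inj₁ e        = pos-≢ c ha hb a≢b e
  ... | inj₂ (inj₁ e) = pos-≢ c ha hd a≢d e
  ... | inj₂ (inj₂ e) = pos-≢ c hb hd b≢d e

  ¬local-triangle : ∀ c {a b d} → c ~ a → c ~ b → c ~ d → a ~ b → b ~ d → ¬ a ~ d
  ¬local-triangle c ha hb hd ab bd ad =
    consecutive-¬triangle (pos-consecutive c ha hb ab) (pos-consecutive c hb hd bd) (pos-consecutive c ha hd ad)

  ¬local-square : ∀ c {a b d e} → c ~ a → c ~ b → c ~ d → c ~ e → a ~ b → b ~ d → d ~ e → e ~ a →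
                  a ≢ d → b ≢ e → ⊥
  ¬local-square c ha hb hd he ab bd de ea a≢d b≢e =
    consecutive-¬square (pos-consecutive c ha hb ab) (pos-consecutive c hb hd bd) (pos-consecutive c hd he de)
                        (pos-consecutive c he ha ea) (pos-≢ c ha hd a≢d) (pos-≢ c hb he b≢e)

  local-edge-leaving : ∀ c {S : Fin n → Set} → Decidable S → ∀ {x y} → c ~ x → S x → c ~ y → ¬ S y →
                       Σ (Fin n) λ s → Σ (Fin n) λ t → c ~ s × c ~ t × S s × ¬ S t × s ~ t
  local-edge-leaving c {S} S? {x} {y} hx sx hy ¬sy with pos c hx ≤? pos c hy
  ... | yes px≤py =
    let (j , j<py , sj , ¬sj+1) = change-point (S? ∘ nb c) (pos c hy) px≤py
                                    (subst S (sym (nb-pos c hx)) sx) (¬sy ∘ subst S (nb-pos c hy))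
        j<end = ≤-trans j<py (pos≤end c hy)
    in nb c j , nb c (suc j) , nb-adj c j , nb-adj c (suc j) , sj , ¬sj+1 ,
       consecutive⇒nb-adj c (<⇒≤ j<end) j<end (inj₁ refl)
  ... | no px≰py =
    let (j , j<px , ¬sj , ¬¬sj+1) = change-point (¬? ∘ S? ∘ nb c) (pos c hx) (<⇒≤ (≰⇒> px≰py))
                                      (¬sy ∘ subst S (nb-pos c hy)) (λ ¬s → ¬s (subst S (sym (nb-pos c hx)) sx))
        j<end = ≤-trans j<px (pos≤end c hx)
    in nb c (suc j) , nb c j , nb-adj c (suc j) , nb-adj c j , decidable-stable (S? _) ¬¬sj+1 , ¬sj ,
       consecutive⇒nb-adj c j<end (<⇒≤ j<end) (inj₂ refl)

  Interior : Fin n → Fin n → Fin n → Fin n → Set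
  Interior c x z t = c ~ t × t ≢ x × t ≢ z

  data Gap (c x z : Fin n) : Set where
    gap₁ : ∀ {t} → Interior c x z t → x ~ t → t ~ z → Gap c x z
    gap₂ : ∀ {t₁ t₂} → Interior c x z t₁ → Interior c x z t₂ → x ~ t₁ → t₁ ~ t₂ → t₂ ~ z → Gap c x z
    gap₃ : ∀ {t₁ t₂ t₃} → Interior c x z t₁ → Interior c x z t₂ → Interior c x z t₃ →
           t₁ ~ t₂ → t₂ ~ t₃ → t₁ ≢ t₃ → Gap c x z

  Interior-flip : ∀ {c x z t} → Interior c x z t → Interior c z x t
  Interior-flip (ct , t≢x , t≢z) = ct , t≢z , t≢x

  Gap-flip : ∀ {c x z} → Gap c x z → Gap c z x
  Gap-flip (gap₁ i xt tz)           = gap₁ (Interior-flip i) (Adj-sym G tz) (Adj-sym G xt)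
  Gap-flip (gap₂ i₁ i₂ xt₁ t₁₂ t₂z) =
    gap₂ (Interior-flip i₂) (Interior-flip i₁) (Adj-sym G t₂z) (Adj-sym G t₁₂) (Adj-sym G xt₁)
  Gap-flip (gap₃ i₁ i₂ i₃ t₁₂ t₂₃ t₁≢t₃) =
    gap₃ (Interior-flip i₁) (Interior-flip i₂) (Interior-flip i₃) t₁₂ t₂₃ t₁≢t₃

  private
    gap-after : ∀ c p e → p + suc (suc e) ≤ end c → Gap c (nb c (p + 0)) (nb c (p + suc (suc e)))
    gap-after c p e p+e+2≤end = gap e refl
      where
      N : ℕ → Fin n
      N i = nb c (p + i)
      bound : ∀ {i} → i ≤ suc (suc e) → p + i ≤ end c
      bound i≤ = ≤-trans (+-monoʳ-≤ p i≤) p+e+2≤end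
      N-≢ : ∀ {i j} → i ≤ suc (suc e) → j ≤ suc (suc e) → i ≢ j → N i ≢ N j
      N-≢ i≤ j≤ i≢j = nb-≢ c (bound i≤) (bound j≤) (i≢j ∘ +-cancelˡ-≡ p _ _)
      inner : ∀ {i} → 0 < i → i < suc (suc e) → Interior c (N 0) (N (suc (suc e))) (N i)
      inner 0<i i<e+2 = nb-adj c _ , N-≢ (<⇒≤ i<e+2) z≤n (>⇒≢ 0<i) , N-≢ (<⇒≤ i<e+2) ≤-refl (<⇒≢ i<e+2)
      edge : ∀ {i} → i < suc (suc e) → N i ~ N (suc i)
      edge {i} i<e+2 = consecutive⇒nb-adj c (bound (<⇒≤ i<e+2)) (bound i<e+2) (inj₁ (sym (+-suc p i)))
      gap : ∀ f → f ≡ e → Gap c (N 0) (N (suc (suc e)))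
      gap zero          refl = gap₁ (inner (s≤s z≤n) (s≤s (s≤s z≤n))) (edge (s≤s z≤n)) (edge (s≤s (s≤s z≤n)))
      gap (suc zero)    refl = gap₂ (inner (s≤s z≤n) (s≤s (s≤s z≤n))) (inner (s≤s z≤n) (s≤s (s≤s (s≤s z≤n))))
                                    (edge (s≤s z≤n)) (edge (s≤s (s≤s z≤n))) (edge (s≤s (s≤s (s≤s z≤n))))
      gap (suc (suc f)) refl = gap₃ (inner (s≤s z≤n) (s≤s (s≤s z≤n))) (inner (s≤s z≤n) (s≤s (s≤s (s≤s z≤n))))
                                    (inner (s≤s z≤n) (s≤s (s≤s (s≤s (s≤s z≤n)))))
                                    (edge (s≤s (s≤s z≤n))) (edge (s≤s (s≤s (s≤s z≤n))))
                                    (N-≢ (s≤s z≤n) (s≤s (s≤s (s≤s z≤n))) (λ ()))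

  private
    gap-ordered : ∀ c {x z} (hx : c ~ x) (hz : c ~ z) → pos c hx < pos c hz → ¬ x ~ z → Gap c x z
    gap-ordered c {x} {z} hx hz px<pz ¬xz with m≤n⇒∃[o]m+o≡n px<pz
    ... | zero , e = ⊥-elim (¬xz (subst₂ _~_ (nb-pos c hx) (nb-pos c hz)
                       (consecutive⇒nb-adj c (pos≤end c hx) (pos≤end c hz) (inj₁ (trans (sym (+-identityʳ _)) e)))))
    ... | suc d , e =
      subst₂ (Gap c) (trans (cong (nb c) (+-identityʳ _)) (nb-pos c hx)) (trans (cong (nb c) e′) (nb-pos c hz))
        (gap-after c (pos c hx) d (subst (_≤ end c) (sym e′) (pos≤end c hz)))
      where
      e′ : pos c hx + suc (suc d) ≡ pos c hz
      e′ = trans (+-suc (pos c hx) (suc d)) e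

  local-gap : ∀ c {x z} (hx : c ~ x) (hz : c ~ z) → x ≢ z → ¬ x ~ z → Gap c x z
  local-gap c hx hz x≢z ¬xz with <-cmp (pos c hx) (pos c hz)
  ... | tri< px<pz _ _ = gap-ordered c hx hz px<pz ¬xz
  ... | tri≈ _ e _     = ⊥-elim (pos-≢ c hx hz x≢z e)
  ... | tri> _ _ pz<px = Gap-flip (gap-ordered c hz hx pz<px (¬xz ∘ Adj-sym G))

-- Threading the far vertices into a Hamiltonian cycle

module Threading {n} (G : Graph n) (LL : LocallyLinear G) (v : Fin n) (R : List (Fin n))
                 (R-sound : ∀ {x} → x ∈ R → ¬ Adj G v x × x ≢ v)
                 (R-complete : ∀ {x} → ¬ Adj G v x → x ≢ v → x ∈ R) where

  open LocalPaths G LL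
  open DecMembership (_≟ᶠ_ {n}) using (_∈?_)

  k : ℕ
  k = end v

  w : ℕ → Fin n
  w = nb v

  v~w : ∀ j → v ~ w j
  v~w = nb-adj v

  w~v : ∀ j → w j ~ v
  w~v j = Adj-sym G (v~w j)

  R-far : ∀ {x} → x ∈ R → ¬ v ~ x
  R-far = proj₁ ∘ R-sound

  R≢v : ∀ {x} → x ∈ R → x ≢ v
  R≢v = proj₂ ∘ R-sound

  w∉R : ∀ j → w j ∉ R
  w∉R j m = R-far m (v~w j)

  R-neighbour≢v : ∀ {x t} → x ∈ R → x ~ t → t ≢ v
  R-neighbour≢v m h refl = R-far m (Adj-sym G h)

  v-adjacent : ∀ {t} → t ≢ v → t ∉ R → v ~ t
  v-adjacent {t} t≢v t∉R with Adj? G v t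
  ... | yes h = h
  ... | no ¬h = ⊥-elim (t∉R (R-complete ¬h t≢v))

  on-path : ∀ {t} → t ≢ v → t ∉ R → Σ ℕ λ j → j ≤ k × t ≡ w j
  on-path t≢v t∉R = let h = v-adjacent t≢v t∉R in pos v h , pos≤end v h , sym (nb-pos v h)

  path-step : ∀ {j t} → j ≤ k → w j ~ t → t ≢ v → t ∉ R → Σ ℕ λ b → b ≤ k × t ≡ w b × Consecutiveℕ j b
  path-step j≤k h t≢v t∉R =
    let (b , b≤k , e) = on-path t≢v t∉R
    in b , b≤k , e , nb-adj⇒consecutive v j≤k b≤k (subst (_ ~_) e h)

  w-edge : ∀ {a} → a < k → w a ~ w (suc a)
  w-edge a<k = consecutive⇒nb-adj v (<⇒≤ a<k) a<k (inj₁ refl)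

  -- Otherwise w (suc a) would have the three neighbours v, y₁, y₂ on the path N(w a).
  slot-conflict : ∀ {a y₁ y₂} → a < k → y₁ ∈ R → y₂ ∈ R → y₁ ≢ y₂ →
                  w a ~ y₁ → w (suc a) ~ y₁ → w a ~ y₂ → w (suc a) ~ y₂ → ⊥
  slot-conflict a<k y₁∈R y₂∈R y₁≢y₂ h₁ h₁′ h₂ h₂′ =
    ¬three-local-neighbours (w _) (w-edge a<k) (w~v _) h₁ h₂ (w~v _) h₁′ h₂′
      (R≢v y₁∈R ∘ sym) (R≢v y₂∈R ∘ sym) y₁≢y₂

  -- A plan for S inserts the chain ins j between w j and w (suc j) on the cycle v, w 0, …, w k, v; together
  -- the chains enumerate S.  The anchor of a chain is a vertex adjacent to both ends of its slot.
  record Plan (S : List (Fin n)) : Set where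
    field
      ins      : ℕ → List (Fin n)
      linked   : ∀ {j} → j < k → Linked _~_ (w j ∷ ins j ++ w (suc j) ∷ [])
      anchored : ∀ {j x} → x ∈ ins j → j < k × Σ (Fin n) λ y → y ∈ ins j × w j ~ y × w (suc j) ~ y
      unique   : ∀ j → Unique (ins j)
      disjoint : ∀ {i j x} → x ∈ ins i → x ∈ ins j → i ≡ j
      ins⊆R    : ∀ {j x} → x ∈ ins j → x ∈ R
      ins⊆S    : ∀ {j x} → x ∈ ins j → x ∈ S
      S⊆ins    : ∀ {x} → x ∈ S → Σ ℕ λ j → x ∈ ins j

  empty-plan : Plan []
  empty-plan = record
    { ins = λ _ → [] ; linked = λ a<k → w-edge a<k ∷ [-] ; anchored = λ () ; unique = λ _ → []
    ; disjoint = λ () ; ins⊆R = λ () ; ins⊆S = λ () ; S⊆ins = λ () }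

  reorder : ∀ {S S′} → Plan S → (∀ {x} → x ∈ S → x ∈ S′) → (∀ {x} → x ∈ S′ → x ∈ S) → Plan S′
  reorder P S⊆S′ S′⊆S = record
    { ins = ins ; linked = linked ; anchored = anchored ; unique = unique ; disjoint = disjoint ; ins⊆R = ins⊆R
    ; ins⊆S = S⊆S′ ∘ ins⊆S ; S⊆ins = S⊆ins ∘ S′⊆S }
    where open Plan P

  slot-plan : ∀ {a ch y} → a < k → Linked _~_ (w a ∷ ch ++ w (suc a) ∷ []) → Unique ch → All (_∈ R) ch →
              y ∈ ch → w a ~ y → w (suc a) ~ y → Plan ch
  slot-plan {a} {ch} {y} a<k link uniq ch⊆R y∈ch ay a′y = record
    { ins = ins ; linked = linked ; anchored = anchored ; unique = unique ; disjoint = disjoint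
    ; ins⊆R = All.lookup ch⊆R ∘ ins⊆ch ; ins⊆S = ins⊆ch ; S⊆ins = λ m → a , subst (_ ∈_) (sym ins-a) m }
    where
    ins : ℕ → List (Fin n)
    ins j with a ≟ j
    ... | yes _ = ch
    ... | no _  = []
    ins-a : ins a ≡ ch
    ins-a with a ≟ a
    ... | yes _  = refl
    ... | no a≢a = ⊥-elim (a≢a refl)
    linked : ∀ {j} → j < k → Linked _~_ (w j ∷ ins j ++ w (suc j) ∷ [])
    linked {j} j<k with a ≟ j
    ... | yes refl = link
    ... | no _     = w-edge j<k ∷ [-]
    anchored : ∀ {j x} → x ∈ ins j → j < k × Σ (Fin n) λ y → y ∈ ins j × w j ~ y × w (suc j) ~ y
    anchored {j} m with a ≟ j
    ... | yes refl = a<k , y , y∈ch , ay , a′y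
    anchored {j} () | no _
    unique : ∀ j → Unique (ins j)
    unique j with a ≟ j
    ... | yes _ = uniq
    ... | no _  = []
    slot : ∀ {j x} → x ∈ ins j → a ≡ j
    slot {j} m with a ≟ j
    ... | yes e = e
    slot {j} () | no _
    disjoint : ∀ {i j x} → x ∈ ins i → x ∈ ins j → i ≡ j
    disjoint m m′ = trans (sym (slot m)) (slot m′)
    ins⊆ch : ∀ {j x} → x ∈ ins j → x ∈ ch
    ins⊆ch {j} m with a ≟ j
    ... | yes _ = m
    ins⊆ch {j} () | no _

  chain-plan : ∀ {i j ch y} → i ≤ k → j ≤ k → Consecutiveℕ i j → Linked _~_ (w i ∷ ch ++ w j ∷ []) →
               Unique ch → All (_∈ R) ch → y ∈ ch → w i ~ y → w j ~ y → Plan ch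
  chain-plan i≤k j≤k (inj₁ refl) link uniq ch⊆R y∈ch iy jy = slot-plan j≤k link uniq ch⊆R y∈ch iy jy
  chain-plan {ch = ch} i≤k j≤k (inj₂ refl) link uniq ch⊆R y∈ch iy jy =
    reorder (slot-plan i≤k (Linked-reverse-chain (Adj-sym G) ch link) (Unique-reverse uniq)
                       (All.tabulate (All.lookup ch⊆R ∘ Any.reverse⁻)) (Any.reverse⁺ y∈ch) jy iy)
            Any.reverse⁻ Any.reverse⁺

  one-chain-per-slot : ∀ {S₁ S₂} (P₁ : Plan S₁) (P₂ : Plan S₂) → (∀ {x} → x ∈ S₁ → x ∉ S₂) →
                       ∀ j → Plan.ins P₁ j ≡ [] ⊎ Plan.ins P₂ j ≡ []
  one-chain-per-slot P₁ P₂ S₁∩S₂≡∅ j with Plan.ins P₁ j in e₁ | Plan.ins P₂ j in e₂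
  ... | []     | _      = inj₁ refl
  ... | _ ∷ _  | []     = inj₂ refl
  ... | x₁ ∷ _ | x₂ ∷ _ =
    let (j<k , y₁ , y₁∈ , h₁ , h₁′) = Plan.anchored P₁ (subst (x₁ ∈_) (sym e₁) (here refl))
        (_   , y₂ , y₂∈ , h₂ , h₂′) = Plan.anchored P₂ (subst (x₂ ∈_) (sym e₂) (here refl))
        y₁≢y₂ = λ e → S₁∩S₂≡∅ (Plan.ins⊆S P₁ y₁∈) (Plan.ins⊆S P₂ (subst (_∈ Plan.ins P₂ j) (sym e) y₂∈))
    in ⊥-elim (slot-conflict j<k (Plan.ins⊆R P₁ y₁∈) (Plan.ins⊆R P₂ y₂∈) y₁≢y₂ h₁ h₁′ h₂ h₂′)

  combine : ∀ {S₁ S₂} → Plan S₁ → Plan S₂ → (∀ {x} → x ∈ S₁ → x ∉ S₂) → Plan (S₁ ++ S₂)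
  combine {S₁} {S₂} P₁ P₂ S₁∩S₂≡∅ = record
    { ins = ins ; linked = linked ; anchored = anchored
    ; unique = λ j → ++⁺ (P₁.unique j) (P₂.unique j) (λ (m₁ , m₂) → apart m₁ m₂)
    ; disjoint = disjoint ; ins⊆R = ins⊆R ; ins⊆S = ins⊆S ; S⊆ins = S⊆ins }
    where
    module P₁ = Plan P₁
    module P₂ = Plan P₂
    ins : ℕ → List (Fin n)
    ins j = P₁.ins j ++ P₂.ins j
    apart : ∀ {i j x} → x ∈ P₁.ins i → x ∉ P₂.ins j
    apart m₁ m₂ = S₁∩S₂≡∅ (P₁.ins⊆S m₁) (P₂.ins⊆S m₂)
    linked : ∀ {j} → j < k → Linked _~_ (w j ∷ ins j ++ w (suc j) ∷ [])
    linked {j} j<k with one-chain-per-slot P₁ P₂ S₁∩S₂≡∅ j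
    ... | inj₁ e = subst (λ xs → Linked _~_ (w j ∷ (xs ++ P₂.ins j) ++ w (suc j) ∷ [])) (sym e) (P₂.linked j<k)
    ... | inj₂ e = subst (λ xs → Linked _~_ (w j ∷ xs ++ w (suc j) ∷ []))
                         (sym (trans (cong (P₁.ins j ++_) e) (++-identityʳ _))) (P₁.linked j<k)
    anchored : ∀ {j x} → x ∈ ins j → j < k × Σ (Fin n) λ y → y ∈ ins j × w j ~ y × w (suc j) ~ y
    anchored {j} m with ∈-++⁻ (P₁.ins j) m
    ... | inj₁ m₁ = let (j<k , y , y∈ , h , h′) = P₁.anchored m₁ in j<k , y , ∈-++⁺ˡ y∈ , h , h′
    ... | inj₂ m₂ = let (j<k , y , y∈ , h , h′) = P₂.anchored m₂ in j<k , y , ∈-++⁺ʳ (P₁.ins j) y∈ , h , h′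
    disjoint : ∀ {i j x} → x ∈ ins i → x ∈ ins j → i ≡ j
    disjoint {i} {j} m m′ with ∈-++⁻ (P₁.ins i) m | ∈-++⁻ (P₁.ins j) m′
    ... | inj₁ m₁ | inj₁ m₁′ = P₁.disjoint m₁ m₁′
    ... | inj₁ m₁ | inj₂ m₂′ = ⊥-elim (apart m₁ m₂′)
    ... | inj₂ m₂ | inj₁ m₁′ = ⊥-elim (apart m₁′ m₂)
    ... | inj₂ m₂ | inj₂ m₂′ = P₂.disjoint m₂ m₂′
    ins⊆R : ∀ {j x} → x ∈ ins j → x ∈ R
    ins⊆R {j} m with ∈-++⁻ (P₁.ins j) m
    ... | inj₁ m₁ = P₁.ins⊆R m₁
    ... | inj₂ m₂ = P₂.ins⊆R m₂
    ins⊆S : ∀ {j x} → x ∈ ins j → x ∈ S₁ ++ S₂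
    ins⊆S {j} m with ∈-++⁻ (P₁.ins j) m
    ... | inj₁ m₁ = ∈-++⁺ˡ (P₁.ins⊆S m₁)
    ... | inj₂ m₂ = ∈-++⁺ʳ S₁ (P₂.ins⊆S m₂)
    S⊆ins : ∀ {x} → x ∈ S₁ ++ S₂ → Σ ℕ λ j → x ∈ ins j
    S⊆ins m with ∈-++⁻ S₁ m
    ... | inj₁ m₁ = let (j , m′) = P₁.S⊆ins m₁ in j , ∈-++⁺ˡ m′
    ... | inj₂ m₂ = let (j , m′) = P₂.S⊆ins m₂ in j , ∈-++⁺ʳ (P₁.ins j) m′

  plan⇒hamiltonian : 3 ≤ n → Plan R → Hamiltonian G
  plan⇒hamiltonian 3≤n P = hamiltonian-from-cycle G 3≤n v tour (All.tabulate v∉tour ∷ tour-unique) cover closed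
    where
    open Plan P
    tour : List (Fin n)
    tour = splice w ins k
    closed : Linked _~_ (v ∷ tour ++ v ∷ [])
    closed = v~w 0 ∷ splice-linked w ins k linked (w~v k ∷ [-])
    v∉tour : ∀ {u} → u ∈ tour → v ≢ u
    v∉tour m v≡u with ∈-splice⁻ w ins k m
    ... | inj₁ (j , _ , e) = Adj-irrefl G (subst (v ~_) (sym (trans v≡u e)) (v~w j))
    ... | inj₂ (j , _ , m′) = R≢v (ins⊆R m′) (sym v≡u)
    tour-unique : Unique tour
    tour-unique = splice-unique w ins k (nb-injective v) (λ m e → w∉R _ (subst (_∈ R) e (ins⊆R m))) unique disjoint
    cover : ∀ u → u ∈ v ∷ tour
    cover u with u ≟ᶠ v
    ... | yes refl = here refl
    ... | no u≢v with Adj? G v u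
    ...   | yes h = there (subst (_∈ tour) (nb-pos v h) (f∈splice w ins (pos≤end v h)))
    ...   | no ¬h = let (j , m) = S⊆ins (R-complete ¬h u≢v) in there (ins⊆splice w ins (proj₁ (anchored m)) m)

  Closed : List (Fin n) → Set
  Closed C = ∀ {a t} → a ∈ C → a ~ t → t ∈ R → t ∈ C

  module Component (conn : Connected G) (C : List (Fin n)) (C⊆R : C ⊆ R) (closed : Closed C) where

    v∉C : v ∉ C
    v∉C m = R≢v (C⊆R m) refl

    w∉C : ∀ j → w j ∉ C
    w∉C j = w∉R j ∘ C⊆R

    exit-on-path : ∀ {a t} → a ∈ C → a ~ t → t ∉ C → Σ ℕ λ j → j ≤ k × t ≡ w j
    exit-on-path a∈C at t∉C = on-path (R-neighbour≢v (C⊆R a∈C) at) (t∉C ∘ closed a∈C at)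

    attached : ∀ {x} → x ∈ C → Σ (Fin n) λ a → Σ ℕ λ i → a ∈ C × i ≤ k × a ~ w i
    attached x∈C =
      let (a , t , a∈C , t∉C , at) = edge-leaving G (_∈? C) (conn _ v) x∈C v∉C
          (i , i≤k , t≡wi) = exit-on-path a∈C at t∉C
      in a , i , a∈C , i≤k , subst (a ~_) t≡wi at

    -- Walk along the path N(w j) from x towards v: the first step out of C lands on some w b.
    local-exit : ∀ {j x} → j ≤ k → x ∈ C → w j ~ x →
                 Σ (Fin n) λ s → Σ ℕ λ b → s ∈ C × b ≤ k × Consecutiveℕ j b × w j ~ s × s ~ w b
    local-exit j≤k x∈C wj~x =
      let (s , t , wj~s , wj~t , s∈C , t∉C , st) = local-edge-leaving (w _) (_∈? C) wj~x x∈C (w~v _) v∉C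
          (b , b≤k , t≡wb , j-b) = path-step j≤k wj~t (R-neighbour≢v (C⊆R s∈C) st) (t∉C ∘ closed s∈C st)
      in s , b , s∈C , b≤k , j-b , wj~s , subst (s ~_) t≡wb st

    -- Walk along the path N(a) from b towards w i: the first step out of C lands on some w j.
    common-neighbour : ∀ {a b i} → b ∈ C → a ~ b → a ~ w i →
                       Σ (Fin n) λ s → Σ ℕ λ j → s ∈ C × a ~ s × j ≤ k × w j ~ a × w j ~ s
    common-neighbour {a} {i = i} b∈C ab a~wi =
      let (s , t , a~s , a~t , s∈C , t∉C , st) = local-edge-leaving a (_∈? C) ab b∈C a~wi (w∉C i)
          (j , j≤k , t≡wj) = exit-on-path s∈C st t∉C
      in s , j , s∈C , a~s , j≤k , Adj-sym G (subst (a ~_) t≡wj a~t) , Adj-sym G (subst (s ~_) t≡wj st)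

    component-plan : ∀ {i j ch y} → i ≤ k → j ≤ k → Consecutiveℕ i j → Linked _~_ (w i ∷ ch ++ w j ∷ []) →
                     Unique ch → All (_∈ C) ch → C ⊆ ch → y ∈ ch → w i ~ y → w j ~ y → Plan C
    component-plan i≤k j≤k i-j link uniq ch⊆C C⊆ch y∈ch iy jy =
      reorder (chain-plan i≤k j≤k i-j link uniq (All.map C⊆R ch⊆C) y∈ch iy jy) (All.lookup ch⊆C) C⊆ch

    singleton-plan : ∀ {x} → C ⊆ x ∷ [] → x ∈ C → Plan C
    singleton-plan {x} C⊆ x∈C =
      let (a , i , a∈C , i≤k , a~wi) = attached x∈C
          wi~x = Adj-sym G (subst (_~ w i) (only a∈C) a~wi)
          (s , b , s∈C , b≤k , i-b , _ , s~wb) = local-exit i≤k x∈C wi~x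
          wb~x = Adj-sym G (subst (_~ w b) (only s∈C) s~wb)
      in component-plan i≤k b≤k i-b (wi~x ∷ Adj-sym G wb~x ∷ [-]) ([] ∷ []) (x∈C ∷ []) C⊆ ∈₀ wi~x wb~x
      where
      only : ∀ {t} → t ∈ C → t ≡ x
      only m with C⊆ m
      ... | here e = e

    private
      edge-finish : ∀ {a s j} → C ⊆ a ∷ s ∷ [] → a ∈ C → s ∈ C → a ~ s → j ≤ k → w j ~ a → w j ~ s → Plan C
      edge-finish C⊆ a∈C s∈C as j≤k ja js with local-exit j≤k a∈C ja
      ... | _ , b , s′∈C , b≤k , j-b , _ , s′b with C⊆ s′∈C
      ...   | ∈₀ = component-plan j≤k b≤k j-b (js ∷ Adj-sym G as ∷ s′b ∷ [-]) ((Adj⇒≢ G (Adj-sym G as) ∷ []) ∷ [] ∷ [])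
                     (s∈C ∷ a∈C ∷ []) (All∈⇒⊆ (∈₁ ∷ ∈₀ ∷ []) ∘ C⊆) ∈₁ ja (Adj-sym G s′b)
      ...   | ∈₁ = component-plan j≤k b≤k j-b (ja ∷ as ∷ s′b ∷ [-]) ((Adj⇒≢ G as ∷ []) ∷ [] ∷ [])
                     (a∈C ∷ s∈C ∷ []) C⊆ ∈₁ js (Adj-sym G s′b)

      edge-from : ∀ {a b i} → C ⊆ a ∷ b ∷ [] → a ∈ C → b ∈ C → a ~ b → i ≤ k → a ~ w i → Plan C
      edge-from C⊆ a∈C b∈C ab _ a~wi with common-neighbour b∈C ab a~wi
      ... | s , j , s∈C , as , j≤k , ja , js with C⊆ s∈C
      ...   | ∈₀ = ⊥-elim (Adj-irrefl G as)
      ...   | ∈₁ = edge-finish C⊆ a∈C s∈C as j≤k ja js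

    edge-plan : ∀ {x y} → C ⊆ x ∷ y ∷ [] → x ∈ C → y ∈ C → x ~ y → Plan C
    edge-plan C⊆ x∈C y∈C xy with attached x∈C
    ... | a , i , a∈C , i≤k , a~wi with C⊆ a∈C
    ...   | ∈₀ = edge-from C⊆ x∈C y∈C xy i≤k a~wi
    ...   | ∈₁ = edge-from (All∈⇒⊆ (∈₁ ∷ ∈₀ ∷ []) ∘ C⊆) y∈C x∈C (Adj-sym G xy) i≤k a~wi

    private
      triangle-finish : ∀ {a s c j} → C ⊆ a ∷ s ∷ c ∷ [] → a ∈ C → s ∈ C → c ∈ C →
                        a ~ s → s ~ c → a ~ c → j ≤ k → w j ~ a → w j ~ s → Plan C
      triangle-finish C⊆ a∈C s∈C c∈C as sc ac j≤k ja js with local-exit j≤k a∈C ja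
      ... | _ , b , s′∈C , b≤k , j-b , js′ , s′b with C⊆ s′∈C
      ...   | ∈₀ = component-plan j≤k b≤k j-b (js ∷ sc ∷ Adj-sym G ac ∷ s′b ∷ [-])
                     (unique₃ (Adj⇒≢ G sc) (Adj⇒≢ G (Adj-sym G as)) (Adj⇒≢ G (Adj-sym G ac)))
                     (s∈C ∷ c∈C ∷ a∈C ∷ []) (All∈⇒⊆ (∈₂ ∷ ∈₀ ∷ ∈₁ ∷ []) ∘ C⊆) ∈₂ ja (Adj-sym G s′b)
      ...   | ∈₁ = component-plan j≤k b≤k j-b (ja ∷ ac ∷ Adj-sym G sc ∷ s′b ∷ [-])
                     (unique₃ (Adj⇒≢ G ac) (Adj⇒≢ G as) (Adj⇒≢ G (Adj-sym G sc)))
                     (a∈C ∷ c∈C ∷ s∈C ∷ []) (All∈⇒⊆ (∈₀ ∷ ∈₂ ∷ ∈₁ ∷ []) ∘ C⊆) ∈₂ js (Adj-sym G s′b)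
      ...   | ∈₂ = ⊥-elim (¬local-triangle (w _) ja js js′ as sc ac)

      triangle-from : ∀ {a b c i} → C ⊆ a ∷ b ∷ c ∷ [] → a ∈ C → b ∈ C → c ∈ C →
                      a ~ b → b ~ c → a ~ c → a ~ w i → Plan C
      triangle-from C⊆ a∈C b∈C c∈C ab bc ac a~wi with common-neighbour b∈C ab a~wi
      ... | s , j , s∈C , as , j≤k , ja , js with C⊆ s∈C
      ...   | ∈₀ = ⊥-elim (Adj-irrefl G as)
      ...   | ∈₁ = triangle-finish C⊆ a∈C b∈C c∈C ab bc ac j≤k ja js
      ...   | ∈₂ = triangle-finish (All∈⇒⊆ (∈₀ ∷ ∈₂ ∷ ∈₁ ∷ []) ∘ C⊆) a∈C c∈C b∈C ac (Adj-sym G bc) ab j≤k ja js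

    triangle-plan : ∀ {x y z} → C ⊆ x ∷ y ∷ z ∷ [] → x ∈ C → y ∈ C → z ∈ C → x ~ y → y ~ z → x ~ z → Plan C
    triangle-plan C⊆ x∈C y∈C z∈C xy yz xz with attached x∈C
    ... | a , i , a∈C , _ , a~wi with C⊆ a∈C
    ...   | ∈₀ = triangle-from C⊆ x∈C y∈C z∈C xy yz xz a~wi
    ...   | ∈₁ = triangle-from (All∈⇒⊆ (∈₁ ∷ ∈₀ ∷ ∈₂ ∷ []) ∘ C⊆) y∈C x∈C z∈C (Adj-sym G xy) xz yz a~wi
    ...   | ∈₂ = triangle-from (All∈⇒⊆ (∈₁ ∷ ∈₂ ∷ ∈₀ ∷ []) ∘ C⊆) z∈C x∈C y∈C (Adj-sym G xz) xy (Adj-sym G yz) a~wi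

    private
      outside : ∀ {a b} → a ∈ C → a ≢ w b
      outside a∈C refl = w∉C _ a∈C

      interior∉C : ∀ {x y z t} → C ⊆ x ∷ y ∷ z ∷ [] → Interior y x z t → t ∉ C
      interior∉C C⊆ (yt , t≢x , t≢z) m with C⊆ m
      ... | ∈₀ = t≢x refl
      ... | ∈₁ = Adj-irrefl G yt
      ... | ∈₂ = t≢z refl

      interior-on-path : ∀ {x y z t} → C ⊆ x ∷ y ∷ z ∷ [] → y ∈ C → Interior y x z t → Σ ℕ λ j → j ≤ k × t ≡ w j
      interior-on-path C⊆ y∈C i = exit-on-path y∈C (proj₁ i) (interior∉C C⊆ i)

    path-plan : ∀ {x y z} → C ⊆ x ∷ y ∷ z ∷ [] → x ∈ C → y ∈ C → z ∈ C → x ≢ z → x ~ y → y ~ z → ¬ x ~ z → Plan C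
    path-plan {x} {y} {z} C⊆ x∈C y∈C z∈C x≢z xy yz ¬xz with local-gap y (Adj-sym G xy) yz x≢z ¬xz
    ... | gap₁ i x~t t~z =
      let (a , a≤k , t≡a) = interior-on-path C⊆ y∈C i
          ax = subst (_~ x) t≡a (Adj-sym G x~t)
          ay = subst (_~ y) t≡a (Adj-sym G (proj₁ i))
          az = subst (_~ z) t≡a t~z
      in through a≤k ax ay az
      where
      through : ∀ {a} → a ≤ k → w a ~ x → w a ~ y → w a ~ z → Plan C
      through {a} a≤k ax ay az with local-exit a≤k x∈C ax
      ... | _ , b , s∈C , b≤k , a-b , _ , sb with C⊆ s∈C
      ...   | ∈₀ = component-plan a≤k b≤k a-b (az ∷ Adj-sym G yz ∷ Adj-sym G xy ∷ sb ∷ [-])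
                     (unique₃ (Adj⇒≢ G (Adj-sym G yz)) (x≢z ∘ sym) (Adj⇒≢ G (Adj-sym G xy)))
                     (z∈C ∷ y∈C ∷ x∈C ∷ []) (All∈⇒⊆ (∈₂ ∷ ∈₁ ∷ ∈₀ ∷ []) ∘ C⊆) ∈₂ ax (Adj-sym G sb)
      ...   | ∈₁ = ⊥-elim (¬three-local-neighbours (w a) ay ax az (consecutive⇒nb-adj v a≤k b≤k a-b)
                     (Adj-sym G xy) yz sb x≢z (outside x∈C) (outside z∈C))
      ...   | ∈₂ = component-plan a≤k b≤k a-b (ax ∷ xy ∷ yz ∷ sb ∷ [-])
                     (unique₃ (Adj⇒≢ G xy) x≢z (Adj⇒≢ G yz)) (x∈C ∷ y∈C ∷ z∈C ∷ []) C⊆ ∈₂ az (Adj-sym G sb)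
    ... | gap₂ i₁ i₂ x~t₁ t₁t₂ t₂~z =
      let (a , a≤k , t₁≡a) = interior-on-path C⊆ y∈C i₁
          (b , b≤k , t₂≡b) = interior-on-path C⊆ y∈C i₂
      in component-plan a≤k b≤k (nb-adj⇒consecutive v a≤k b≤k (subst₂ _~_ t₁≡a t₂≡b t₁t₂))
           (subst (_~ x) t₁≡a (Adj-sym G x~t₁) ∷ xy ∷ yz ∷ subst (z ~_) t₂≡b (Adj-sym G t₂~z) ∷ [-])
           (unique₃ (Adj⇒≢ G xy) x≢z (Adj⇒≢ G yz)) (x∈C ∷ y∈C ∷ z∈C ∷ []) C⊆ ∈₁
           (subst (_~ y) t₁≡a (Adj-sym G (proj₁ i₁))) (subst (_~ y) t₂≡b (Adj-sym G (proj₁ i₂)))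
    -- The interior vertices lie in N(v), so three consecutive ones would close the 4-cycle v t₁ y t₃ inside N(t₂).
    ... | gap₃ i₁ i₂ i₃ t₁t₂ t₂t₃ t₁≢t₃ =
      ⊥-elim (¬local-square _ (Adj-sym G (v~interior i₂)) (Adj-sym G t₁t₂) (Adj-sym G (proj₁ i₂)) t₂t₃
                (v~interior i₁) (Adj-sym G (proj₁ i₁)) (proj₁ i₃) (Adj-sym G (v~interior i₃))
                (λ v≡y → R≢v (C⊆R y∈C) (sym v≡y)) t₁≢t₃)
      where
      v~interior : ∀ {t} → Interior y x z t → v ~ t
      v~interior i = let (j , _ , t≡j) = interior-on-path C⊆ y∈C i in subst (v ~_) (sym t≡j) (v~w j)

  module _ (conn : Connected G) where

    private
      module Whole = Component conn R (λ m → m) (λ _ _ m → m)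

    singleton : ∀ {x} → x ∈ R → Closed (x ∷ []) → Plan (x ∷ [])
    singleton x∈R closed = Component.singleton-plan conn _ (All∈⇒⊆ (x∈R ∷ [])) closed (λ m → m) ∈₀

    edge : ∀ {x y} → x ∈ R → y ∈ R → x ~ y → Closed (x ∷ y ∷ []) → Plan (x ∷ y ∷ [])
    edge x∈R y∈R xy closed = Component.edge-plan conn _ (All∈⇒⊆ (x∈R ∷ y∈R ∷ [])) closed (λ m → m) ∈₀ ∈₁ xy

    split : ∀ {C} C₁ C₂ → Closed C → C ⊆ C₁ ++ C₂ → C₁ ⊆ C → C₂ ⊆ C →
            (∀ {a b} → a ∈ C₁ → b ∈ C₂ → ¬ a ~ b) → (∀ {a} → a ∈ C₁ → a ∉ C₂) →
            (Closed C₁ → Plan C₁) → (Closed C₂ → Plan C₂) → Plan C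
    split C₁ C₂ closed C⊆ C₁⊆C C₂⊆C no-edge disjoint plan₁ plan₂ =
      reorder (combine (plan₁ closed₁) (plan₂ closed₂) disjoint) (λ m → [ C₁⊆C , C₂⊆C ]′ (∈-++⁻ C₁ m)) C⊆
      where
      closed₁ : Closed C₁
      closed₁ a∈C₁ at t∈R with ∈-++⁻ C₁ (C⊆ (closed (C₁⊆C a∈C₁) at t∈R))
      ... | inj₁ t∈C₁ = t∈C₁
      ... | inj₂ t∈C₂ = ⊥-elim (no-edge a∈C₁ t∈C₂ at)
      closed₂ : Closed C₂
      closed₂ b∈C₂ bt t∈R with ∈-++⁻ C₁ (C⊆ (closed (C₂⊆C b∈C₂) bt t∈R))
      ... | inj₁ t∈C₁ = ⊥-elim (no-edge t∈C₁ b∈C₂ (Adj-sym G bt))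
      ... | inj₂ t∈C₂ = t∈C₂

    plan-for-one : ∀ {x} → R ⊆ x ∷ [] → x ∈ R → Plan R
    plan-for-one R⊆ x∈R = Whole.singleton-plan R⊆ x∈R

    plan-for-two : ∀ {x y} → R ⊆ x ∷ y ∷ [] → x ∈ R → y ∈ R → x ≢ y → Plan R
    plan-for-two {x} {y} R⊆ x∈R y∈R x≢y with Adj? G x y
    ... | yes xy = Whole.edge-plan R⊆ x∈R y∈R xy
    ... | no ¬xy = split (x ∷ []) (y ∷ []) (λ _ _ m → m) R⊆ (All∈⇒⊆ (x∈R ∷ [])) (All∈⇒⊆ (y∈R ∷ []))
                     (λ { ∈₀ ∈₀ → ¬xy }) (λ { ∈₀ ∈₀ → x≢y refl }) (singleton x∈R) (singleton y∈R)

    plan-for-three : ∀ {x y z} → R ⊆ x ∷ y ∷ z ∷ [] → x ∈ R → y ∈ R → z ∈ R → x ≢ y → x ≢ z → y ≢ z → Plan R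
    plan-for-three {x} {y} {z} R⊆ x∈R y∈R z∈R x≢y x≢z y≢z with Adj? G x y | Adj? G y z | Adj? G x z
    ... | yes xy | yes yz | yes xz = Whole.triangle-plan R⊆ x∈R y∈R z∈R xy yz xz
    ... | yes xy | yes yz | no ¬xz = Whole.path-plan R⊆ x∈R y∈R z∈R x≢z xy yz ¬xz
    ... | yes xy | no ¬yz | yes xz =
      Whole.path-plan (All∈⇒⊆ (∈₁ ∷ ∈₀ ∷ ∈₂ ∷ []) ∘ R⊆) y∈R x∈R z∈R y≢z (Adj-sym G xy) xz ¬yz
    ... | no ¬xy | yes yz | yes xz =
      Whole.path-plan (All∈⇒⊆ (∈₀ ∷ ∈₂ ∷ ∈₁ ∷ []) ∘ R⊆) x∈R z∈R y∈R x≢y xz (Adj-sym G yz) ¬xy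
    ... | yes xy | no ¬yz | no ¬xz =
      split (x ∷ y ∷ []) (z ∷ []) (λ _ _ m → m) R⊆ (All∈⇒⊆ (x∈R ∷ y∈R ∷ [])) (All∈⇒⊆ (z∈R ∷ []))
        (λ { ∈₀ ∈₀ → ¬xz ; ∈₁ ∈₀ → ¬yz }) (λ { ∈₀ ∈₀ → x≢z refl ; ∈₁ ∈₀ → y≢z refl })
        (edge x∈R y∈R xy) (singleton z∈R)
    ... | no ¬xy | yes yz | no ¬xz =
      split (x ∷ []) (y ∷ z ∷ []) (λ _ _ m → m) R⊆ (All∈⇒⊆ (x∈R ∷ [])) (All∈⇒⊆ (y∈R ∷ z∈R ∷ []))
        (λ { ∈₀ ∈₀ → ¬xy ; ∈₀ ∈₁ → ¬xz }) (λ { ∈₀ ∈₀ → x≢y refl ; ∈₀ ∈₁ → x≢z refl })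
        (singleton x∈R) (edge y∈R z∈R yz)
    ... | no ¬xy | no ¬yz | yes xz =
      split (x ∷ z ∷ []) (y ∷ []) (λ _ _ m → m) (All∈⇒⊆ (∈₀ ∷ ∈₂ ∷ ∈₁ ∷ []) ∘ R⊆)
        (All∈⇒⊆ (x∈R ∷ z∈R ∷ [])) (All∈⇒⊆ (y∈R ∷ []))
        (λ { ∈₀ ∈₀ → ¬xy ; ∈₁ ∈₀ → ¬yz ∘ Adj-sym G }) (λ { ∈₀ ∈₀ → x≢y refl ; ∈₁ ∈₀ → y≢z refl })
        (edge x∈R z∈R xz) (singleton y∈R)
    ... | no ¬xy | no ¬yz | no ¬xz =
      split (x ∷ []) (y ∷ z ∷ []) (λ _ _ m → m) R⊆ (All∈⇒⊆ (x∈R ∷ [])) (All∈⇒⊆ (y∈R ∷ z∈R ∷ []))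
        (λ { ∈₀ ∈₀ → ¬xy ; ∈₀ ∈₁ → ¬xz }) (λ { ∈₀ ∈₀ → x≢y refl ; ∈₀ ∈₁ → x≢z refl })
        (singleton x∈R)
        (λ closed → split (y ∷ []) (z ∷ []) closed (λ m → m) (All∈⇒⊆ (∈₀ ∷ [])) (All∈⇒⊆ (∈₁ ∷ []))
                      (λ { ∈₀ ∈₀ → ¬yz }) (λ { ∈₀ ∈₀ → y≢z refl }) (singleton y∈R) (singleton z∈R))

-- The degree bound

module DegreeBound {n} (G : Graph n) (LL : LocallyLinear G) (conn : Connected G) (3≤n : 3 ≤ n) where

  Far : Fin n → Fin n → Set
  Far v x = ¬ Adj G v x × x ≢ v

  Far? : ∀ v → Decidable (Far v)
  Far? v x = ¬? (Adj? G v x) ×-dec ¬? (x ≟ᶠ v)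

  far-vertices : Fin n → List (Fin n)
  far-vertices v = filter (Far? v) (allFin n)

  degree+far : ∀ v → suc (degree G v + length (far-vertices v)) ≡ n
  degree+far v = begin
    suc (degree G v + length F)          ≡⟨ cong (λ d → suc (d + length F)) (degree≡length-Neighbours G v) ⟩
    suc (length N + length F)            ≡⟨ cong suc (sym (length-++ N)) ⟩
    length (v ∷ N ++ F)                  ≡⟨ length-of-enumeration (v ∷ N ++ F) unique cover ⟩
    n                                    ∎
    where
    open ≡-Reasoning
    N F : List (Fin n)
    N = Neighbours G v
    F = far-vertices v
    unique : Unique (v ∷ N ++ F)
    unique = All.tabulate v∉ ∷ ++⁺ (filter⁺ (Adj? G v) (allFin⁺ n)) (filter⁺ (Far? v) (allFin⁺ n)) apart
      where
      v∉ : ∀ {u} → u ∈ N ++ F → v ≢ u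
      v∉ m refl with ∈-++⁻ N m
      ... | inj₁ m₁ = Adj-irrefl G (proj₂ (∈-filter⁻ (Adj? G v) {xs = allFin n} m₁))
      ... | inj₂ m₂ = proj₂ (proj₂ (∈-filter⁻ (Far? v) {xs = allFin n} m₂)) refl
      apart : ∀ {u} → ¬ (u ∈ N × u ∈ F)
      apart (m₁ , m₂) = proj₁ (proj₂ (∈-filter⁻ (Far? v) {xs = allFin n} m₂)) (proj₂ (∈-filter⁻ (Adj? G v) {xs = allFin n} m₁))
    cover : ∀ u → u ∈ v ∷ N ++ F
    cover u with u ≟ᶠ v | Adj? G v u
    ... | yes refl | _     = here refl
    ... | no u≢v   | yes h = there (∈-++⁺ˡ (∈-filter⁺ (Adj? G v) (∈-allFin u) h))
    ... | no u≢v   | no ¬h = there (∈-++⁺ʳ N (∈-filter⁺ (Far? v) (∈-allFin u) (¬h , u≢v)))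

  few-far⇒hamiltonian : ∀ v R → Unique R → (∀ {x} → x ∈ R → Far v x) → (∀ {x} → ¬ Adj G v x → x ≢ v → x ∈ R) →
                        length R ≤ 3 → Hamiltonian G
  few-far⇒hamiltonian v [] _ sound complete _ =
    plan⇒hamiltonian 3≤n empty-plan
    where open Threading G LL v [] sound complete
  few-far⇒hamiltonian v (x ∷ []) _ sound complete _ =
    plan⇒hamiltonian 3≤n (plan-for-one conn (λ m → m) ∈₀)
    where open Threading G LL v (x ∷ []) sound complete
  few-far⇒hamiltonian v (x ∷ y ∷ []) ((x≢y ∷ []) ∷ _) sound complete _ =
    plan⇒hamiltonian 3≤n (plan-for-two conn (λ m → m) ∈₀ ∈₁ x≢y)
    where open Threading G LL v (x ∷ y ∷ []) sound complete
  few-far⇒hamiltonian v (x ∷ y ∷ z ∷ []) ((x≢y ∷ x≢z ∷ []) ∷ (y≢z ∷ []) ∷ _) sound complete _ =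
    plan⇒hamiltonian 3≤n (plan-for-three conn (λ m → m) ∈₀ ∈₁ ∈₂ x≢y x≢z y≢z)
    where open Threading G LL v (x ∷ y ∷ z ∷ []) sound complete
  few-far⇒hamiltonian v (_ ∷ _ ∷ _ ∷ _ ∷ _) _ _ _ (s≤s (s≤s (s≤s ())))

  degree+5≤n : ¬ Hamiltonian G → ∀ v → degree G v + 5 ≤ n
  degree+5≤n ¬ham v with length (far-vertices v) ≤? 3
  ... | yes few = ⊥-elim (¬ham (few-far⇒hamiltonian v (far-vertices v) (filter⁺ (Far? v) (allFin⁺ n))
                                  (λ m → proj₂ (∈-filter⁻ (Far? v) {xs = allFin n} m))
                                  (λ ¬h x≢v → ∈-filter⁺ (Far? v) (∈-allFin _) (¬h , x≢v)) few))
  ... | no many = begin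
    degree G v + 5                            ≤⟨ +-monoʳ-≤ (degree G v) (s≤s (≰⇒> many)) ⟩
    degree G v + suc (length (far-vertices v)) ≡⟨ +-suc (degree G v) _ ⟩
    suc (degree G v + length (far-vertices v)) ≡⟨ degree+far v ⟩
    n                                         ∎
    where open ≤-Reasoning

maxDegree-bound : (n : ℕ) → 3 ≤ n → (G : Graph n) → Connected G → ¬ Hamiltonian G → LocallyLinear G →
                  maxDegree G + 5 ≤ n
maxDegree-bound (suc m) 3≤n G conn ¬ham LL = begin
  maxDegree G + 5         ≤⟨ +-monoˡ-≤ 5 (maxDegree-lub G (λ v → m+n≤o⇒m≤o∸n (degree G v) (bound v))) ⟩
  suc m ∸ 5 + 5           ≡⟨ m∸n+n≡m (≤-trans (m≤n+m 5 _) (bound zero)) ⟩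
  suc m                   ∎
  where
  open ≤-Reasoning
  bound : ∀ v → degree G v + 5 ≤ suc m
  bound = DegreeBound.degree+5≤n G LL conn 3≤n ¬ham

-- Hamiltonian cycles

module HamiltonianCycle {m} (G : Graph (suc m)) (2≤m : 2 ≤ m) (σ : Fin (suc m) → Fin (suc m))
                        (σ-injective : Injective _≡_ _≡_ σ) (σ-adjacent : ∀ i → Adj G (σ i) (σ (sucMod i))) where

  private
    V : Set
    V = Fin (suc m)

  position : V → V
  position x = proj₁ (injective⇒surjective σ σ-injective x)

  σ-position : ∀ x → σ (position x) ≡ x
  σ-position x = proj₂ (injective⇒surjective σ σ-injective x)

  next : V → V
  next x = σ (sucMod (position x))

  next-σ : ∀ i → next (σ i) ≡ σ (sucMod i)
  next-σ i = cong (σ ∘ sucMod) (σ-injective (σ-position (σ i)))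

  next-injective : Injective _≡_ _≡_ next
  next-injective {x} {y} e = trans (sym (σ-position x)) (trans (cong σ (sucMod-injective (σ-injective e))) (σ-position y))

  prev : V → V
  prev x = proj₁ (injective⇒surjective next next-injective x)

  next-prev : ∀ x → next (prev x) ≡ x
  next-prev x = proj₂ (injective⇒surjective next next-injective x)

  next≢prev : ∀ x → next x ≢ prev x
  next≢prev x n≡p = sucMod²≢id 2≤m (position x) (σ-injective (begin
    σ (sucMod (sucMod (position x))) ≡⟨ next-σ (sucMod (position x)) ⟨
    next (σ (sucMod (position x)))    ≡⟨ cong next (next-σ (position x)) ⟨
    next (next (σ (position x)))      ≡⟨ cong (next ∘ next) (σ-position x) ⟩
    next (next x)                     ≡⟨ cong next n≡p ⟩
    next (prev x)                     ≡⟨ next-prev x ⟩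
    x                                 ≡⟨ σ-position x ⟨
    σ (position x)                    ∎))
    where open ≡-Reasoning

  CycleNeighbour : V → V → Set
  CycleNeighbour x y = y ≡ next x ⊎ x ≡ next y

  CycleNeighbour-sym : ∀ {x y} → CycleNeighbour x y → CycleNeighbour y x
  CycleNeighbour-sym = Sum.swap

  CycleNeighbour⇒Adj : ∀ {x y} → CycleNeighbour x y → Adj G x y
  CycleNeighbour⇒Adj {x} (inj₁ refl) = subst (λ z → Adj G z (next x)) (σ-position x) (σ-adjacent (position x))
  CycleNeighbour⇒Adj     (inj₂ refl) = Adj-sym G (CycleNeighbour⇒Adj (inj₁ refl))

  cycle-neighbours : ∀ {x y} → CycleNeighbour x y → y ≡ next x ⊎ y ≡ prev x
  cycle-neighbours     (inj₁ e) = inj₁ e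
  cycle-neighbours {x} (inj₂ e) = inj₂ (next-injective (trans (sym e) (sym (next-prev x))))

  exactly-two : ∀ {x a b c} → CycleNeighbour x a → CycleNeighbour x b → a ≢ b → CycleNeighbour x c → c ≡ a ⊎ c ≡ b
  exactly-two {x} xa xb a≢b xc with cycle-neighbours xa | cycle-neighbours xb | cycle-neighbours xc
  ... | inj₁ refl | inj₁ refl | _         = ⊥-elim (a≢b refl)
  ... | inj₂ refl | inj₂ refl | _         = ⊥-elim (a≢b refl)
  ... | inj₁ refl | inj₂ refl | inj₁ refl = inj₁ refl
  ... | inj₁ refl | inj₂ refl | inj₂ refl = inj₂ refl
  ... | inj₂ refl | inj₁ refl | inj₁ refl = inj₂ refl
  ... | inj₂ refl | inj₁ refl | inj₂ refl = inj₁ refl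

  forced : ∀ {x a b} → (∀ {y} → CycleNeighbour x y → y ≡ a ⊎ y ≡ b) → CycleNeighbour x a × CycleNeighbour x b
  forced {x} only with only (inj₁ refl) | only (inj₂ (sym (next-prev x)))
  ... | inj₁ n≡a | inj₁ p≡a = ⊥-elim (next≢prev x (trans n≡a (sym p≡a)))
  ... | inj₂ n≡b | inj₂ p≡b = ⊥-elim (next≢prev x (trans n≡b (sym p≡b)))
  ... | inj₁ n≡a | inj₂ p≡b = inj₁ (sym n≡a) , inj₂ (trans (sym (next-prev x)) (cong next p≡b))
  ... | inj₂ n≡b | inj₁ p≡a = inj₂ (trans (sym (next-prev x)) (cong next p≡a)) , inj₁ (sym n≡b)

  closed-under-next : {Q : V → Set} → (∀ {x} → Q x → Q (next x)) → ∀ {x} y → Q x → Q y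
  closed-under-next {Q} closed {x} y qx =
    subst Q (σ-position y)
      (sucMod-reaches (λ i q → subst Q (next-σ i) (closed q)) (position x) (position y) (subst Q (sym (σ-position x)) qx))

-- Graphs with adjacency computed on ℕ

consecutiveᵇ : ℕ → ℕ → Bool
consecutiveᵇ a b = (b ≡ᵇ suc a) ∨ (a ≡ᵇ suc b)

consecutiveᵇ⇒consecutive : ∀ a b → consecutiveᵇ a b ≡ true → Consecutiveℕ a b
consecutiveᵇ⇒consecutive a b e with Equivalence.to T-∨ (Equivalence.from T-≡ e)
... | inj₁ t = inj₁ (sym (≡ᵇ⇒≡ b (suc a) t))
... | inj₂ t = inj₂ (sym (≡ᵇ⇒≡ a (suc b) t))

consecutive⇒consecutiveᵇ : ∀ a b → Consecutiveℕ a b → consecutiveᵇ a b ≡ true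
consecutive⇒consecutiveᵇ a b c =
  Equivalence.to T-≡ (Equivalence.from T-∨ (Sum.map (≡⇒≡ᵇ b (suc a) ∘ sym) (≡⇒≡ᵇ a (suc b) ∘ sym) c))

module ℕGraph (adjℕ : ℕ → ℕ → Bool) (adjℕ-sym : ∀ a b → adjℕ a b ≡ adjℕ b a)
              (adjℕ-irrefl : ∀ a → adjℕ a a ≡ false) (N : ℕ) where

  open DecMembership Data.Nat._≟_ using () renaming (_∈?_ to _∈ℕ?_)
  open DecUnique Data.Nat._≟_ using (unique?)

  G : Graph N
  G = record { adj = λ u w → adjℕ (toℕ u) (toℕ w) ; sym = λ u w → adjℕ-sym (toℕ u) (toℕ w)
             ; irrfl = λ u → adjℕ-irrefl (toℕ u) }

  record PathCertificate (u : ℕ) : Set where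
    field
      first    : ℕ
      rest     : List ℕ
      bounded  : All (_< N) (first ∷ rest)
      unique   : Unique (first ∷ rest)
      adjacent : All (λ x → adjℕ u x ≡ true) (first ∷ rest)
      complete : ∀ {x} → x < N → adjℕ u x ≡ true → x ∈ first ∷ rest
      path     : ∀ {a b} → a < suc (length rest) → b < suc (length rest) →
                 adjℕ (nth 0 (first ∷ rest) a) (nth 0 (first ∷ rest) b) ≡ consecutiveᵇ a b

  certificate⇒path : ∀ u → PathCertificate (toℕ u) → NeighbourhoodIsPath G u
  certificate⇒path u c = length rest , w , w-injective , w-adjacent , w-onto , w-path
    where
    open PathCertificate c
    ns : List ℕ
    ns = first ∷ rest
    w : Fin (suc (length rest)) → Fin N
    w i = fromℕ< (All.lookup bounded (nth-∈ 0 ns (toℕ<n i)))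
    toℕ-w : ∀ i → toℕ (w i) ≡ nth 0 ns (toℕ i)
    toℕ-w i = toℕ-fromℕ< _
    w-injective : Injective _≡_ _≡_ w
    w-injective {i} {j} e =
      toℕ-injective (nth-injective 0 unique (toℕ<n i) (toℕ<n j) (trans (sym (toℕ-w i)) (trans (cong toℕ e) (toℕ-w j))))
    w-adjacent : ∀ i → Adj G u (w i)
    w-adjacent i = subst (λ x → adjℕ (toℕ u) x ≡ true) (sym (toℕ-w i)) (All.lookup adjacent (nth-∈ 0 ns (toℕ<n i)))
    w-onto : ∀ x → Adj G u x → Σ (Fin (suc (length rest))) λ i → w i ≡ x
    w-onto x h =
      let (a , a< , e) = nth-index 0 (complete (toℕ<n x) h)
      in fromℕ< a< , toℕ-injective (trans (toℕ-w (fromℕ< a<)) (trans (cong (nth 0 ns) (toℕ-fromℕ< a<)) e))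
    adj-w : ∀ i j → adj G (w i) (w j) ≡ consecutiveᵇ (toℕ i) (toℕ j)
    adj-w i j = trans (cong₂ adjℕ (toℕ-w i) (toℕ-w j)) (path (toℕ<n i) (toℕ<n j))
    w-path : ∀ i j → (Adj G (w i) (w j) → Consecutive i j) × (Consecutive i j → Adj G (w i) (w j))
    w-path i j = (λ h → consecutiveᵇ⇒consecutive _ _ (trans (sym (adj-w i j)) h))
               , (λ c → trans (adj-w i j) (consecutive⇒consecutiveᵇ _ _ c))

  certificate-degree : ∀ u → (c : PathCertificate (toℕ u)) → degree G u ≡ suc (length (PathCertificate.rest c))
  certificate-degree u c = degree-path-neighbourhood G u (certificate⇒path u c)

  -- A certificate for a vertex whose neighbours all lie below c, in a form that is decided by evaluation.
  Checkable : ℕ → ℕ → List ℕ → Set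
  Checkable c u ns =
    All (_< c) ns × Unique ns × All (λ x → adjℕ u x ≡ true) ns × (∀ {x} → x < c → adjℕ u x ≡ true → x ∈ ns) ×
    (∀ {a} → a < length ns → ∀ {b} → b < length ns → adjℕ (nth 0 ns a) (nth 0 ns b) ≡ consecutiveᵇ a b)

  checkable? : ∀ c u ns → Dec (Checkable c u ns)
  checkable? c u ns =
    All.all? (_<? c) ns ×-dec unique? ns ×-dec All.all? (λ x → adjℕ u x ≟ᵇ true) ns ×-dec
    allUpTo? (λ x → (adjℕ u x ≟ᵇ true) →-dec (x ∈ℕ? ns)) c ×-dec
    allUpTo? (λ a → allUpTo? (λ b → adjℕ (nth 0 ns a) (nth 0 ns b) ≟ᵇ consecutiveᵇ a b) (length ns)) (length ns)

  checked-certificate : ∀ {c u y ys} → c ≤ N → Checkable c u (y ∷ ys) → (∀ r → adjℕ u (c + r) ≡ false) →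
                        PathCertificate u
  checked-certificate {c} {u} {y} {ys} c≤N (bounded , unique , adjacent , complete , path) beyond = record
    { first = y ; rest = ys ; bounded = All.map (λ x<c → ≤-trans x<c c≤N) bounded ; unique = unique
    ; adjacent = adjacent ; complete = complete′ ; path = λ a< b< → path a< b< }
    where
    complete′ : ∀ {x} → x < N → adjℕ u x ≡ true → x ∈ y ∷ ys
    complete′ {x} _ h with x <? c
    ... | yes x<c = complete x<c h
    ... | no x≮c with m≤n⇒∃[o]m+o≡n (≮⇒≥ x≮c)
    ...   | r , refl with () ← trans (sym h) (beyond r)

-- The extremal graphs

-- Each edge is listed at its smaller end: 0 is joined to every vertex from 5 on, those vertices form the
-- path 5 – 6 – 7 – ⋯, and 1, …, 4 are attached to the path through a fixed gadget.
edge↑ : ℕ → ℕ → Bool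
edge↑ 0 b = 5 ≤ᵇ b
edge↑ 1 b = (b ≡ᵇ 2) ∨ (b ≡ᵇ 3) ∨ (b ≡ᵇ 4) ∨ (b ≡ᵇ 7) ∨ (b ≡ᵇ 9) ∨ (b ≡ᵇ 10)
edge↑ 2 b = (b ≡ᵇ 6) ∨ (b ≡ᵇ 7) ∨ (b ≡ᵇ 10)
edge↑ 3 b = b ≡ᵇ 7
edge↑ 4 b = b ≡ᵇ 9
edge↑ (suc (suc (suc (suc (suc a))))) b = b ≡ᵇ 6 + a

adjacentℕ : ℕ → ℕ → Bool
adjacentℕ a b = edge↑ a b ∨ edge↑ b a

adjacentℕ-sym : ∀ a b → adjacentℕ a b ≡ adjacentℕ b a
adjacentℕ-sym a b = ∨-comm (edge↑ a b) (edge↑ b a)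

consecutiveᵇ-false : ∀ {a b} → ¬ Consecutiveℕ a b → consecutiveᵇ a b ≡ false
consecutiveᵇ-false {a} {b} ¬c with consecutiveᵇ a b in e
... | false = refl
... | true  = ⊥-elim (¬c (consecutiveᵇ⇒consecutive a b e))

path-adjacent : ∀ a b → adjacentℕ (5 + a) (5 + b) ≡ consecutiveᵇ a b
path-adjacent a b = refl

adjacentℕ-irrefl : ∀ a → adjacentℕ a a ≡ false
adjacentℕ-irrefl 0 = refl
adjacentℕ-irrefl 1 = refl
adjacentℕ-irrefl 2 = refl
adjacentℕ-irrefl 3 = refl
adjacentℕ-irrefl 4 = refl
adjacentℕ-irrefl (suc (suc (suc (suc (suc a))))) = consecutiveᵇ-false {a} {a} [ 1+n≢n , 1+n≢n ]′

ExtremalGraph : ℕ → Set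
ExtremalGraph n = Σ (Graph n) λ G → Connected G × ¬ Hamiltonian G × LocallyLinear G × maxDegree G ≡ n ∸ 5

module Extremal (t : ℕ) where

  open ℕGraph adjacentℕ adjacentℕ-sym adjacentℕ-irrefl (12 + t)

  private
    N : ℕ
    N = 12 + t

  small-certificate : ∀ u y ys → True (checkable? 12 u (y ∷ ys)) → (∀ r → adjacentℕ u (12 + r) ≡ false) →
                      PathCertificate u
  small-certificate u y ys ok = checked-certificate (m≤m+n 12 t) (toWitness ok)

  hub-certificate : PathCertificate 0
  hub-certificate = record
    { first = 5 ; rest = applyUpTo (6 +_) (6 + t)
    ; bounded = All.tabulate λ m → let (i , i< , e) = ∈-applyUpTo⁻ (5 +_) m in subst (_< N) (sym e) (+-monoʳ-< 5 i<)
    ; unique = applyUpTo⁺₁ (5 +_) (7 + t) (λ i<j _ → <⇒≢ i<j ∘ +-cancelˡ-≡ 5 _ _)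
    ; adjacent = All.tabulate λ m → let (i , _ , e) = ∈-applyUpTo⁻ (5 +_) m in subst (λ x → adjacentℕ 0 x ≡ true) (sym e) refl
    ; complete = complete
    ; path = λ {a} {b} a< b< →
        trans (cong₂ adjacentℕ (nth-applyUpTo 0 (5 +_) (bound a<)) (nth-applyUpTo 0 (5 +_) (bound b<))) (path-adjacent a b)
    }
    where
    bound : ∀ {a} → a < suc (length (applyUpTo (6 +_) (6 + t))) → a < 7 + t
    bound {a} = subst (a <_) (cong suc (length-applyUpTo (6 +_) (6 + t)))
    complete : ∀ {x} → x < N → adjacentℕ 0 x ≡ true → x ∈ applyUpTo (5 +_) (7 + t)
    complete {suc (suc (suc (suc (suc i))))} (s≤s (s≤s (s≤s (s≤s (s≤s i<))))) _ = ∈-applyUpTo⁺ (5 +_) i<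
    complete {0} _ ()
    complete {1} _ ()
    complete {2} _ ()
    complete {3} _ ()
    complete {4} _ ()

  tail-neighbour : ∀ s {x} → adjacentℕ (11 + s) x ≡ true → x ≡ 10 + s ⊎ x ≡ 0 ⊎ x ≡ 12 + s
  tail-neighbour s {0} _ = inj₂ (inj₁ refl)
  tail-neighbour s {1} ()
  tail-neighbour s {2} ()
  tail-neighbour s {3} ()
  tail-neighbour s {4} ()
  tail-neighbour s {suc (suc (suc (suc (suc r))))} h with consecutiveᵇ⇒consecutive (6 + s) r h
  ... | inj₁ refl = inj₂ (inj₂ refl)
  ... | inj₂ refl = inj₁ refl

  private
    ¬consecutive-gap : ∀ a → ¬ Consecutiveℕ a (2 + a)
    ¬consecutive-gap a (inj₁ ())
    ¬consecutive-gap a (inj₂ ())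

  last-certificate : PathCertificate (11 + t)
  last-certificate = record
    { first = 10 + t ; rest = 0 ∷ []
    ; bounded = +-monoʳ-≤ 11 (n≤1+n t) ∷ s≤s z≤n ∷ []
    ; unique = ((λ ()) ∷ []) ∷ [] ∷ []
    ; adjacent = consecutive⇒consecutiveᵇ (6 + t) (5 + t) (inj₂ refl) ∷ refl ∷ []
    ; complete = λ {x} x<N h → [ here , [ there ∘ here , (λ { refl → ⊥-elim (<-irrefl refl x<N) }) ]′ ]′ (tail-neighbour t h)
    ; path = path
    }
    where
    path : ∀ {a b} → a < 2 → b < 2 → adjacentℕ (nth 0 (10 + t ∷ 0 ∷ []) a) (nth 0 (10 + t ∷ 0 ∷ []) b) ≡ consecutiveᵇ a b
    path {0} {0} _ _ = adjacentℕ-irrefl (10 + t)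
    path {0} {1} _ _ = refl
    path {1} {0} _ _ = refl
    path {1} {1} _ _ = refl
    path {suc (suc _)} (s≤s (s≤s ())) _
    path {_} {suc (suc _)} _ (s≤s (s≤s ()))

  inner-tail-certificate : ∀ {s} → s < t → PathCertificate (11 + s)
  inner-tail-certificate {s} s<t = record
    { first = 10 + s ; rest = 0 ∷ 12 + s ∷ []
    ; bounded = +-monoʳ-≤ 11 (m≤n⇒m≤1+n (<⇒≤ s<t)) ∷ s≤s z≤n ∷ +-monoʳ-< 12 s<t ∷ []
    ; unique = unique₃ (λ ()) (λ ()) (λ ())
    ; adjacent = consecutive⇒consecutiveᵇ (6 + s) (5 + s) (inj₂ refl) ∷ refl ∷
                 consecutive⇒consecutiveᵇ (6 + s) (7 + s) (inj₁ refl) ∷ []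
    ; complete = λ h → [ here , [ there ∘ here , there ∘ there ∘ here ]′ ]′ ∘ tail-neighbour s
    ; path = path
    }
    where
    ns : List ℕ
    ns = 10 + s ∷ 0 ∷ 12 + s ∷ []
    path : ∀ {a b} → a < 3 → b < 3 → adjacentℕ (nth 0 ns a) (nth 0 ns b) ≡ consecutiveᵇ a b
    path {0} {0} _ _ = adjacentℕ-irrefl (10 + s)
    path {0} {1} _ _ = refl
    path {0} {2} _ _ = consecutiveᵇ-false (¬consecutive-gap (5 + s))
    path {1} {0} _ _ = refl
    path {1} {1} _ _ = refl
    path {1} {2} _ _ = refl
    path {2} {0} _ _ = consecutiveᵇ-false (¬consecutive-gap (5 + s) ∘ consecutive-sym)
    path {2} {1} _ _ = refl
    path {2} {2} _ _ = adjacentℕ-irrefl (12 + s)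
    path {suc (suc (suc _))} (s≤s (s≤s (s≤s ()))) _
    path {_} {suc (suc (suc _))} _ (s≤s (s≤s (s≤s ())))

  tail-certificate : ∀ s → s ≤ t → PathCertificate (11 + s)
  tail-certificate s s≤t with m≤n⇒m<n∨m≡n s≤t
  ... | inj₁ s<t = inner-tail-certificate s<t
  ... | inj₂ refl = last-certificate

  pattern 10F = suc 9F
  pattern 11+ i = suc (suc (suc (suc (suc (suc (suc (suc (suc (suc (suc i))))))))))

  certificate : (u : Fin N) → PathCertificate (toℕ u)
  certificate 0F      = hub-certificate
  certificate 1F      = small-certificate 1  3 (7 ∷ 2 ∷ 10 ∷ 9 ∷ 4 ∷ []) _ (λ _ → refl)
  certificate 2F      = small-certificate 2  6 (7 ∷ 1 ∷ 10 ∷ [])         _ (λ _ → refl)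
  certificate 3F      = small-certificate 3  1 (7 ∷ [])                   _ (λ _ → refl)
  certificate 4F      = small-certificate 4  1 (9 ∷ [])                   _ (λ _ → refl)
  certificate 5F      = small-certificate 5  0 (6 ∷ [])                   _ (λ _ → refl)
  certificate 6F      = small-certificate 6  2 (7 ∷ 0 ∷ 5 ∷ [])           _ (λ _ → refl)
  certificate 7F      = small-certificate 7  3 (1 ∷ 2 ∷ 6 ∷ 0 ∷ 8 ∷ [])   _ (λ _ → refl)
  certificate 8F      = small-certificate 8  7 (0 ∷ 9 ∷ [])               _ (λ _ → refl)
  certificate 9F      = small-certificate 9  4 (1 ∷ 10 ∷ 0 ∷ 8 ∷ [])      _ (λ _ → refl)
  certificate 10F     = small-certificate 10 2 (1 ∷ 9 ∷ 0 ∷ 11 ∷ [])      _ (λ _ → refl)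
  certificate (11+ i) = tail-certificate (toℕ i) (s≤s⁻¹ (toℕ<n i))

  locally-linear : LocallyLinear G
  locally-linear u = certificate⇒path u (certificate u)

  connected : Connected G
  connected = connected-via-hub G 0F to-hub
    where
    to-hub : (u : Fin N) → Reachable G u 0F
    to-hub 0F      = here
    to-hub 1F      = step {w = 7F} refl (step refl here)
    to-hub 2F      = step {w = 6F} refl (step refl here)
    to-hub 3F      = step {w = 7F} refl (step refl here)
    to-hub 4F      = step {w = 9F} refl (step refl here)
    to-hub 5F      = step refl here
    to-hub 6F      = step refl here
    to-hub 7F      = step refl here
    to-hub 8F      = step refl here
    to-hub 9F      = step refl here
    to-hub 10F     = step refl here
    to-hub (11+ _) = step refl here

  maxDegree≡7+t : maxDegree G ≡ 7 + t
  maxDegree≡7+t = ≤-antisym (maxDegree-lub G degree≤7+t) (subst (_≤ maxDegree G) hub-degree (degree≤maxDegree G 0F))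
    where
    hub-degree : degree G 0F ≡ 7 + t
    hub-degree = trans (certificate-degree 0F hub-certificate) (cong suc (length-applyUpTo (6 +_) (6 + t)))
    small : ∀ k → T (k ≤ᵇ 7) → k ≤ 7 + t
    small k k≤7 = ≤-trans (≤ᵇ⇒≤ k 7 k≤7) (m≤m+n 7 t)
    tail-bound : ∀ s s≤t → suc (length (PathCertificate.rest (tail-certificate s s≤t))) ≤ 7 + t
    tail-bound s s≤t with m≤n⇒m<n∨m≡n s≤t
    ... | inj₁ _    = small 3 _
    ... | inj₂ refl = small 2 _
    bound : (u : Fin N) → suc (length (PathCertificate.rest (certificate u))) ≤ 7 + t
    bound 0F      = ≤-reflexive (cong suc (length-applyUpTo (6 +_) (6 + t)))
    bound 1F      = small _ _
    bound 2F      = small _ _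
    bound 3F      = small _ _
    bound 4F      = small _ _
    bound 5F      = small _ _
    bound 6F      = small _ _
    bound 7F      = small _ _
    bound 8F      = small _ _
    bound 9F      = small _ _
    bound 10F     = small _ _
    bound (11+ i) = tail-bound (toℕ i) _
    degree≤7+t : ∀ u → degree G u ≤ 7 + t
    degree≤7+t u = subst (_≤ 7 + t) (sym (certificate-degree u (certificate u))) (bound u)

  on-hexagon : ℕ → Bool
  on-hexagon 1 = true
  on-hexagon 3 = true
  on-hexagon 4 = true
  on-hexagon 7 = true
  on-hexagon 8 = true
  on-hexagon 9 = true
  on-hexagon _ = false

  Hexagon : Fin N → Set
  Hexagon y = T (on-hexagon (toℕ y))

  listed : ∀ u {y} → Adj G u y → toℕ y ∈ PathCertificate.first (certificate u) ∷ PathCertificate.rest (certificate u)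
  listed u {y} = PathCertificate.complete (certificate u) (toℕ<n y)

  among₂ : ∀ {y a b : Fin N} → toℕ y ∈ toℕ a ∷ toℕ b ∷ [] → y ≡ a ⊎ y ≡ b
  among₂ (here e)         = inj₁ (toℕ-injective e)
  among₂ (there (here e)) = inj₂ (toℕ-injective e)

  last penultimate : Fin N
  last        = fromℕ< (n<1+n (11 + t))
  penultimate = fromℕ< (m≤n⇒m≤1+n (n<1+n (10 + t)))

  toℕ-last : toℕ last ≡ 11 + t
  toℕ-last = toℕ-fromℕ< (n<1+n (11 + t))

  last-neighbours : ∀ {y} → Adj G last y → y ≡ penultimate ⊎ y ≡ 0F
  last-neighbours {y} h = identify (tail-neighbour t (subst (λ a → adjacentℕ a (toℕ y) ≡ true) toℕ-last h))
    where
    identify : toℕ y ≡ 10 + t ⊎ toℕ y ≡ 0 ⊎ toℕ y ≡ 12 + t → y ≡ penultimate ⊎ y ≡ 0F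
    identify (inj₁ e)        = inj₁ (toℕ-injective (trans e (sym (toℕ-fromℕ< (m≤n⇒m≤1+n (n<1+n (10 + t)))))))
    identify (inj₂ (inj₁ e)) = inj₂ (toℕ-injective e)
    identify (inj₂ (inj₂ e)) = ⊥-elim (<-irrefl e (toℕ<n y))

  5≢last : 5F ≢ last
  5≢last e with () ← trans (cong toℕ e) toℕ-last

  8≢last : 8F ≢ last
  8≢last e with () ← trans (cong toℕ e) toℕ-last

  -- 3, 4, 5 and the last vertex have degree two, so both their cycle edges are forced; those at 0 then
  -- rule out the cycle edge 0 – 8, after which 1, 3, 7, 8, 9, 4 already carry a closed cycle.
  module NoHamiltonianCycle (σ : Fin N → Fin N) (σ-injective : Injective _≡_ _≡_ σ)
                            (σ-adjacent : ∀ i → Adj G (σ i) (σ (sucMod i))) where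

    open HamiltonianCycle G (s≤s (s≤s z≤n)) σ σ-injective σ-adjacent

    degree-two : ∀ {x a b} → (∀ {y} → Adj G x y → y ≡ a ⊎ y ≡ b) → CycleNeighbour x a × CycleNeighbour x b
    degree-two nbrs = forced (nbrs ∘ CycleNeighbour⇒Adj)

    at-3 : CycleNeighbour 3F 1F × CycleNeighbour 3F 7F
    at-3 = degree-two (among₂ ∘ listed 3F)

    at-4 : CycleNeighbour 4F 1F × CycleNeighbour 4F 9F
    at-4 = degree-two (among₂ ∘ listed 4F)

    at-5 : CycleNeighbour 5F 0F × CycleNeighbour 5F 6F
    at-5 = degree-two (among₂ ∘ listed 5F)

    at-last : CycleNeighbour last penultimate × CycleNeighbour last 0F
    at-last = degree-two last-neighbours

    ¬0-8 : ¬ CycleNeighbour 0F 8F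
    ¬0-8 c = [ (λ ()) , 8≢last ]′ (exactly-two (CycleNeighbour-sym (proj₁ at-5)) (CycleNeighbour-sym (proj₂ at-last)) 5≢last c)

    at-8 : CycleNeighbour 8F 7F × CycleNeighbour 8F 9F
    at-8 = forced λ c → case listed 8F (CycleNeighbour⇒Adj c) of λ where
      (here e)                 → inj₁ (toℕ-injective e)
      (there (here e))         → ⊥-elim (¬0-8 (subst (λ z → CycleNeighbour z 8F) (toℕ-injective e) (CycleNeighbour-sym c)))
      (there (there (here e))) → inj₂ (toℕ-injective e)

    either : ∀ {c a b} → c ≡ a ⊎ c ≡ b → Hexagon a → Hexagon b → Hexagon c
    either (inj₁ refl) ha _ = ha
    either (inj₂ refl) _ hb = hb

    hexagon-closed : ∀ y {c} → Hexagon y → CycleNeighbour y c → Hexagon c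
    hexagon-closed 1F _ c = either (exactly-two (CycleNeighbour-sym (proj₁ at-3)) (CycleNeighbour-sym (proj₁ at-4)) (λ ()) c) _ _
    hexagon-closed 3F _ c = either (among₂ {a = 1F} {7F} (listed 3F (CycleNeighbour⇒Adj c))) _ _
    hexagon-closed 4F _ c = either (among₂ {a = 1F} {9F} (listed 4F (CycleNeighbour⇒Adj c))) _ _
    hexagon-closed 7F _ c = either (exactly-two (CycleNeighbour-sym (proj₂ at-3)) (CycleNeighbour-sym (proj₁ at-8)) (λ ()) c) _ _
    hexagon-closed 8F _ c = either (exactly-two (proj₁ at-8) (proj₂ at-8) (λ ()) c) _ _
    hexagon-closed 9F _ c = either (exactly-two (CycleNeighbour-sym (proj₂ at-4)) (CycleNeighbour-sym (proj₂ at-8)) (λ ()) c) _ _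

    0-on-hexagon : Hexagon 0F
    0-on-hexagon = closed-under-next (λ {x} hx → hexagon-closed x hx (inj₁ refl)) {1F} 0F _

  ¬hamiltonian : ¬ Hamiltonian G
  ¬hamiltonian (_ , σ , σ-injective , σ-adjacent) = NoHamiltonianCycle.0-on-hexagon σ σ-injective σ-adjacent

  extremal : ExtremalGraph (12 + t)
  extremal = G , connected , ¬hamiltonian , locally-linear , maxDegree≡7+t

extremal-graphs : (n : ℕ) → 12 ≤ n → ExtremalGraph n
extremal-graphs n 12≤n = let (t , 12+t≡n) = m≤n⇒∃[o]m+o≡n 12≤n in subst ExtremalGraph 12+t≡n (Extremal.extremal t)

lemma2 : ((n : ℕ) → 3 ≤ n → (G : Graph n) → Connected G → ¬ Hamiltonian G → LocallyLinear G →
              maxDegree G + 5 ≤ n)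
         × ((n : ℕ) → 12 ≤ n → Σ (Graph n) λ G →
              Connected G × ¬ Hamiltonian G × LocallyLinear G × maxDegree G ≡ n ∸ 5)
lemma2 = maxDegree-bound , extremal-graphs
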